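{- Let $n > \ell \geq 0$ be integers with $n \geq 3\ell$. Then $(n,\ell)$ is quasi-perfect. Moreover, unless $n = 3\ell$ and $2 \leq \ell \leq 5$, the pair $(n,\ell)$ is perfect.
   Context: $[n]=\{1,\dots,n\}$. For $\mathcal F \subset 2^{[n]}$ the binomial norm is $\|\mathcal F\|_n = \sum_{F \in \mathcal F} 1\big/\binom{n}{|F|}$. A family $\mathcal F \subset 2^{[n]}$ is a complex (down-set) if $E \subset F \in \mathcal F$ implies $E \in \mathcal F$. For a pair $(n,\ell)$ with $n > \ell \geq 0$ consider the inequality \[ (\ast)\qquad |\mathcal F| \geq \sum_{0 \leq i < \ell} \binom{n}{i} + (\|\mathcal F\|_n - \ell)\binom{n}{\ell}. \] The pair $(n,\ell)$ is perfect if $(\ast)$ holds for every complex $\mathcal F \subset 2^{[n]}$ with $\|\mathcal F\|_n < n+1$, and quasi-perfect if $(\ast)$ holds for every complex $\mathcal F \subset 2^{[n]}$ with $\|\mathcal F\|_n < \frac{n+1}{2}$. -}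

module Defs where

open import Data.Nat as ℕ using (ℕ; zero; suc)
open import Data.Nat.Combinatorics using (_C_)
open import Data.Integer using (+_)
open import Data.Rational using (ℚ; _/_; 0ℚ; _+_; _-_; _*_; _≤_; _<_)
open import Data.Bool using (Bool; true; false)
open import Data.Bool.Properties using () renaming (_≟_ to _≟ᵇ_)
open import Data.List using (List; []; _∷_; map; _++_; filter; length; foldr)
open import Data.Vec using ([]; _∷_)
open import Data.Fin.Subset using (Subset; _⊆_; ∣_∣; inside; outside)
open import Relation.Binary.PropositionalEquality using (_≡_)

ℕtoℚ : ℕ → ℚ
ℕtoℚ k = + k / 1

-- 1/k as a rational (only ever applied to binomial coefficients C(n,|F|) ≥ 1;
-- the value at 0 is an irrelevant convention).
inv : ℕ → ℚ
inv zero    = 0ℚ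
inv (suc k) = + 1 / suc k

allSubsets : (n : ℕ) → List (Subset n)
allSubsets zero    = [] ∷ []
allSubsets (suc n) = map (outside ∷_) (allSubsets n) ++ map (inside ∷_) (allSubsets n)

Family : ℕ → Set
Family n = Subset n → Bool

members : {n : ℕ} → Family n → List (Subset n)
members {n} 𝓕 = filter (λ s → 𝓕 s ≟ᵇ true) (allSubsets n)

card : {n : ℕ} → Family n → ℕ
card 𝓕 = length (members 𝓕)

norm : {n : ℕ} → Family n → ℚ
norm {n} 𝓕 = foldr (λ s acc → inv (n C ∣ s ∣) + acc) 0ℚ (members 𝓕)

IsComplex : {n : ℕ} → Family n → Set
IsComplex {n} 𝓕 = (E F : Subset n) → E ⊆ F → 𝓕 F ≡ true → 𝓕 E ≡ true

binomSumBelow : ℕ → ℕ → ℕ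
binomSumBelow n zero    = 0
binomSumBelow n (suc ℓ) = binomSumBelow n ℓ ℕ.+ n C ℓ

Ineq : (n ℓ : ℕ) → Family n → Set
Ineq n ℓ 𝓕 =
  ℕtoℚ (binomSumBelow n ℓ) + (norm 𝓕 - ℕtoℚ ℓ) * ℕtoℚ (n C ℓ) ≤ ℕtoℚ (card 𝓕)

Perfect : ℕ → ℕ → Set
Perfect n ℓ = (𝓕 : Family n) → IsComplex 𝓕 → norm 𝓕 < ℕtoℚ (suc n) → Ineq n ℓ 𝓕

QuasiPerfect : ℕ → ℕ → Set
QuasiPerfect n ℓ = (𝓕 : Family n) → IsComplex 𝓕 → norm 𝓕 < + (suc n) / 2 → Ineq n ℓ 𝓕

module Submission where

-- Let x_i = f_i / C(n,i) be the density of the i-th layer of a complex F. Then ‖F‖ = ∑ x_i and |F| = ∑ x_i C(n,i),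
-- so |F| minus the right-hand side of (∗) is
--   ∑_{i<ℓ} (1 - x_i) (C(n,ℓ) - C(n,i))  +  ∑_{j≤n-ℓ} x_{ℓ+j} (C(n,ℓ+j) - C(n,ℓ)).
-- The first sum is non-negative since C(n,·) increases up to ℓ ≤ (n+1)/2. The local LYM inequality makes x
-- non-increasing, so by summation by parts the second sum is non-negative provided every partial sum
-- ∑_{j<t} (C(n,ℓ+j) - C(n,ℓ)) is, except where x_{ℓ+t-1} = x_{ℓ+t} = 0. A complex containing a k-set contains all
-- its subsets, so ‖F‖ < n+1 forces x_n = 0 and ‖F‖ < (n+1)/2 forces x_{n-1} = 0 as well; hence only the partial
-- sums up to t = n-ℓ (perfect) or t = n-ℓ-1 (quasi-perfect) are needed. For n ≥ 3ℓ they follow from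
-- 2^n = ∑ C(n,i) and the bound (n-ℓ+1) C(n,ℓ) + n + 1 ≤ 2^n, which propagates by induction on n-ℓ and along the
-- diagonal n = 3ℓ from a few computed cases; the remaining small cases are computed directly, and for n = 3ℓ with
-- 2 ≤ ℓ ≤ 5 only the partial sums needed for quasi-perfection hold.

open import Defs
open import Algebra.Bundles using (CommutativeSemigroup)
open import Algebra.Structures using (IsCommutativeMonoid)
open import Data.Nat.Base using (ℕ; zero; suc; s≤s; z≤n)
open import Function using (_∘_)
open import Relation.Binary.PropositionalEquality

module Sums {a} {A : Set a} {_∙_ : A → A → A} {ε : A}
            (isCommutativeMonoid : IsCommutativeMonoid _≡_ _∙_ ε) where
  open import Data.Nat.Base using (_+_; _<_)
  open IsCommutativeMonoid isCommutativeMonoid using (assoc; identityˡ; identityʳ; isCommutativeSemigroup)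

  private
    commutativeSemigroup : CommutativeSemigroup a a
    commutativeSemigroup = record { isCommutativeSemigroup = isCommutativeSemigroup }

  open import Algebra.Properties.CommutativeSemigroup commutativeSemigroup using (interchange)

  ∑ : ℕ → (ℕ → A) → A
  ∑ zero    f = ε
  ∑ (suc t) f = f 0 ∙ ∑ t (f ∘ suc)

  ∑-cong : ∀ t {f g} → (∀ i → i < t → f i ≡ g i) → ∑ t f ≡ ∑ t g
  ∑-cong zero    f≡g = refl
  ∑-cong (suc t) f≡g = cong₂ _∙_ (f≡g 0 (s≤s z≤n)) (∑-cong t (λ i i<t → f≡g (suc i) (s≤s i<t)))

  ∑-+ : ∀ s t f → ∑ (s + t) f ≡ ∑ s f ∙ ∑ t (λ i → f (s + i))
  ∑-+ zero    t f = sym (identityˡ _)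
  ∑-+ (suc s) t f = trans (cong (f 0 ∙_) (∑-+ s t (f ∘ suc))) (sym (assoc (f 0) _ _))

  ∑-last : ∀ t f → ∑ (suc t) f ≡ ∑ t f ∙ f t
  ∑-last zero    f = trans (identityʳ (f 0)) (sym (identityˡ (f 0)))
  ∑-last (suc t) f = trans (cong (f 0 ∙_) (∑-last t (f ∘ suc))) (sym (assoc (f 0) _ _))

  ∑-distrib : ∀ t f g → ∑ t (λ i → f i ∙ g i) ≡ ∑ t f ∙ ∑ t g
  ∑-distrib zero    f g = sym (identityˡ ε)
  ∑-distrib (suc t) f g = begin
    (f 0 ∙ g 0) ∙ ∑ t (λ i → f (suc i) ∙ g (suc i)) ≡⟨ cong ((f 0 ∙ g 0) ∙_) (∑-distrib t (f ∘ suc) (g ∘ suc)) ⟩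
    (f 0 ∙ g 0) ∙ (F ∙ G)                             ≡⟨ interchange (f 0) (g 0) F G ⟩
    (f 0 ∙ F) ∙ (g 0 ∙ G)                             ∎
    where
    open ≡-Reasoning
    F G : A
    F = ∑ t (f ∘ suc)
    G = ∑ t (g ∘ suc)

∑-homo : ∀ {a b} {A : Set a} {B : Set b} {_∙_ : A → A → A} {ε : A} {_⊕_ : B → B → B} {η : B}
         (M : IsCommutativeMonoid _≡_ _∙_ ε) (N : IsCommutativeMonoid _≡_ _⊕_ η)
         (h : A → B) → h ε ≡ η → (∀ x y → h (x ∙ y) ≡ h x ⊕ h y) →
         ∀ t f → h (Sums.∑ M t f) ≡ Sums.∑ N t (h ∘ f)
∑-homo M N h h-ε h-∙ zero    f = h-ε
∑-homo {_⊕_ = _⊕_} M N h h-ε h-∙ (suc t) f = trans (h-∙ (f 0) _) (cong (h (f 0) ⊕_) (∑-homo M N h h-ε h-∙ t (f ∘ suc)))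

module NatSums where
  open import Data.Nat.Base using (_+_; _*_; _∸_; _≤_; _<_)
  open import Data.Nat.Properties
  open import Data.Nat.Tactic.RingSolver using (solve-∀)
  open Sums +-0-isCommutativeMonoid

  ∑-mono-≤ : ∀ t {f g} → (∀ i → i < t → f i ≤ g i) → ∑ t f ≤ ∑ t g
  ∑-mono-≤ zero    f≤g = z≤n
  ∑-mono-≤ (suc t) f≤g = +-mono-≤ (f≤g 0 (s≤s z≤n)) (∑-mono-≤ t (λ i i<t → f≤g (suc i) (s≤s i<t)))

  ∑-const : ∀ t c → ∑ t (λ _ → c) ≡ t * c
  ∑-const zero    c = refl
  ∑-const (suc t) c = cong (c +_) (∑-const t c)

  gauss : ∀ k → ∑ (suc k) (k ∸_) * 2 ≡ k * suc k
  gauss zero    = refl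
  gauss (suc k) = begin
    (suc k + ∑ (suc k) (k ∸_)) * 2     ≡⟨ *-distribʳ-+ 2 (suc k) _ ⟩
    suc k * 2 + ∑ (suc k) (k ∸_) * 2   ≡⟨ cong (suc k * 2 +_) (gauss k) ⟩
    suc k * 2 + k * suc k              ≡⟨ collect k ⟩
    suc k * suc (suc k)                ∎
    where
    open ≡-Reasoning
    collect : ∀ k → suc k * 2 + k * suc k ≡ suc k * suc (suc k)
    collect = solve-∀

module Rationals where
  open import Data.Nat.Base as ℕ using ()
  import Data.Nat.Properties as ℕₚ
  open import Data.Nat.Coprimality using (1-coprimeTo) renaming (sym to coprime-sym)
  open import Data.Integer.Base as ℤ using (+_)
  import Data.Integer.Properties as ℤₚ
  open import Data.Integer.Tactic.RingSolver using () renaming (solve-∀ to ℤ-solve-∀)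
  open import Data.Rational.Base using (ℚ; mkℚ; _/_; 0ℚ; 1ℚ; _+_; _-_; _*_; -_; _≤_; *≤*; toℚᵘ; nonNegative)
  open import Data.Rational.Properties
  open import Data.Rational.Unnormalised.Base as ℚᵘ using (mkℚᵘ; *≡*)
  import Data.Rational.Unnormalised.Properties as ℚᵘₚ
  open import Relation.Nullary.Decidable.Core using (dec⇒maybe)
  open import Level using (0ℓ)
  open import Tactic.RingSolver using (solve-∀)
  open import Tactic.RingSolver.Core.AlmostCommutativeRing using (AlmostCommutativeRing; fromCommutativeRing)

  ℚ-ring : AlmostCommutativeRing 0ℓ 0ℓ
  ℚ-ring = fromCommutativeRing +-*-commutativeRing (λ x → dec⇒maybe (0ℚ ≟ x))

  toℚᵘ-ℕtoℚ : ∀ k → toℚᵘ (ℕtoℚ k) ≡ mkℚᵘ (+ k) 0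
  toℚᵘ-ℕtoℚ k rewrite normalize-coprime (coprime-sym (1-coprimeTo k)) = refl

  ℕtoℚ-homo-+ : ∀ a b → ℕtoℚ (a ℕ.+ b) ≡ ℕtoℚ a + ℕtoℚ b
  ℕtoℚ-homo-+ a b = toℚᵘ-injective (begin
    toℚᵘ (ℕtoℚ (a ℕ.+ b))                       ≡⟨ toℚᵘ-ℕtoℚ (a ℕ.+ b) ⟩
    mkℚᵘ (+ (a ℕ.+ b)) 0                         ≈⟨ *≡* (trans (cong (ℤ._* (+ 1 ℤ.* + 1)) (ℤₚ.pos-+ a b)) (sum-over-1 (+ a) (+ b))) ⟩
    mkℚᵘ (+ a) 0 ℚᵘ.+ mkℚᵘ (+ b) 0               ≡⟨ cong₂ ℚᵘ._+_ (toℚᵘ-ℕtoℚ a) (toℚᵘ-ℕtoℚ b) ⟨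
    toℚᵘ (ℕtoℚ a) ℚᵘ.+ toℚᵘ (ℕtoℚ b)             ≈⟨ toℚᵘ-homo-+ (ℕtoℚ a) (ℕtoℚ b) ⟨
    toℚᵘ (ℕtoℚ a + ℕtoℚ b)                       ∎)
    where
    open ℚᵘₚ.≃-Reasoning
    sum-over-1 : ∀ x y → (x ℤ.+ y) ℤ.* (+ 1 ℤ.* + 1) ≡ (x ℤ.* + 1 ℤ.+ y ℤ.* + 1) ℤ.* + 1
    sum-over-1 = ℤ-solve-∀

  ℕtoℚ-homo-* : ∀ a b → ℕtoℚ (a ℕ.* b) ≡ ℕtoℚ a * ℕtoℚ b
  ℕtoℚ-homo-* a b = toℚᵘ-injective (begin
    toℚᵘ (ℕtoℚ (a ℕ.* b))                       ≡⟨ toℚᵘ-ℕtoℚ (a ℕ.* b) ⟩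
    mkℚᵘ (+ (a ℕ.* b)) 0                         ≈⟨ *≡* (trans (cong (ℤ._* (+ 1 ℤ.* + 1)) (ℤₚ.pos-* a b)) (product-over-1 (+ a) (+ b))) ⟩
    mkℚᵘ (+ a) 0 ℚᵘ.* mkℚᵘ (+ b) 0               ≡⟨ cong₂ ℚᵘ._*_ (toℚᵘ-ℕtoℚ a) (toℚᵘ-ℕtoℚ b) ⟨
    toℚᵘ (ℕtoℚ a) ℚᵘ.* toℚᵘ (ℕtoℚ b)             ≈⟨ toℚᵘ-homo-* (ℕtoℚ a) (ℕtoℚ b) ⟨
    toℚᵘ (ℕtoℚ a * ℕtoℚ b)                       ∎)
    where
    open ℚᵘₚ.≃-Reasoning
    product-over-1 : ∀ x y → (x ℤ.* y) ℤ.* (+ 1 ℤ.* + 1) ≡ (x ℤ.* y) ℤ.* + 1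
    product-over-1 = ℤ-solve-∀

  ℕtoℚ-mono-≤ : ∀ {a b} → a ℕ.≤ b → ℕtoℚ a ≤ ℕtoℚ b
  ℕtoℚ-mono-≤ {a} {b} a≤b = toℚᵘ-cancel-≤ (subst₂ ℚᵘ._≤_ (sym (toℚᵘ-ℕtoℚ a)) (sym (toℚᵘ-ℕtoℚ b))
    (ℚᵘ.*≤* (subst₂ ℤ._≤_ (sym (ℤₚ.*-identityʳ (+ a))) (sym (ℤₚ.*-identityʳ (+ b))) (ℤ.+≤+ a≤b))))

  infixl 7 _÷_
  _÷_ : ℕ → ℕ → ℚ
  a ÷ b = ℕtoℚ a * inv b

  inv-inverse : ∀ k → inv (suc k) * ℕtoℚ (suc k) ≡ 1ℚ
  inv-inverse k rewrite normalize-coprime (1-coprimeTo (suc k)) | normalize-coprime (coprime-sym (1-coprimeTo (suc k))) =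
    *-inverseˡ (mkℚ (+ suc k) 0 (coprime-sym (1-coprimeTo (suc k))))

  ÷-inverse : ∀ a {b} → 1 ℕ.≤ b → a ÷ b * ℕtoℚ b ≡ ℕtoℚ a
  ÷-inverse a {suc b} _ = trans (*-assoc (ℕtoℚ a) _ _) (trans (cong (ℕtoℚ a *_) (inv-inverse b)) (*-identityʳ _))

  ÷-self : ∀ {b} → 1 ℕ.≤ b → b ÷ b ≡ 1ℚ
  ÷-self {suc b} _ = trans (*-comm (ℕtoℚ (suc b)) (inv (suc b))) (inv-inverse b)

  0≤inv : ∀ k → 0ℚ ≤ inv k
  0≤inv zero = ≤-refl
  0≤inv (suc k) rewrite normalize-coprime (1-coprimeTo (suc k)) = *≤* (ℤ.+≤+ ℕ.z≤n)

  p≤q⇒0≤q-p : ∀ {p q} → p ≤ q → 0ℚ ≤ q - p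
  p≤q⇒0≤q-p {p} {q} p≤q = subst (_≤ q - p) (+-inverseʳ p) (+-monoˡ-≤ (- p) p≤q)

  0≤* : ∀ {p q} → 0ℚ ≤ p → 0ℚ ≤ q → 0ℚ ≤ p * q
  0≤* {p} {q} 0≤p 0≤q = nonNegative⁻¹ (p * q) {{nonNeg*nonNeg⇒nonNeg p {{nonNegative 0≤p}} q {{nonNegative 0≤q}}}}

  ÷-mono-≤ : ∀ {a b c d} → 1 ℕ.≤ b → 1 ℕ.≤ d → a ℕ.* d ℕ.≤ c ℕ.* b → a ÷ b ≤ c ÷ d
  ÷-mono-≤ {a} {suc b} {c} {suc d} _ _ ad≤cb = begin
    a ÷ suc b                                   ≡⟨ ÷-expand a b d ⟩
    ℕtoℚ (a ℕ.* suc d) * (inv (suc b) * inv (suc d)) ≤⟨ *-monoʳ-≤-nonNeg _ {{nonNegative 0≤invs}} (ℕtoℚ-mono-≤ ad≤cb) ⟩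
    ℕtoℚ (c ℕ.* suc b) * (inv (suc b) * inv (suc d)) ≡⟨ cong (ℕtoℚ (c ℕ.* suc b) *_) (*-comm (inv (suc b)) (inv (suc d))) ⟩
    ℕtoℚ (c ℕ.* suc b) * (inv (suc d) * inv (suc b)) ≡⟨ ÷-expand c d b ⟨
    c ÷ suc d                                   ∎
    where
    open ≤-Reasoning
    0≤invs : 0ℚ ≤ inv (suc b) * inv (suc d)
    0≤invs = 0≤* (0≤inv (suc b)) (0≤inv (suc d))
    ÷-expand : ∀ a b e → a ÷ suc b ≡ ℕtoℚ (a ℕ.* suc e) * (inv (suc b) * inv (suc e))
    ÷-expand a b e = begin-equality
      ℕtoℚ a * inv (suc b)                                  ≡⟨ *-identityʳ _ ⟨
      ℕtoℚ a * inv (suc b) * 1ℚ                             ≡⟨ cong (ℕtoℚ a * inv (suc b) *_) (inv-inverse e) ⟨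
      ℕtoℚ a * inv (suc b) * (inv (suc e) * ℕtoℚ (suc e))   ≡⟨ shuffle (ℕtoℚ a) (inv (suc b)) (inv (suc e)) (ℕtoℚ (suc e)) ⟩
      ℕtoℚ a * ℕtoℚ (suc e) * (inv (suc b) * inv (suc e))   ≡⟨ cong (_* (inv (suc b) * inv (suc e))) (ℕtoℚ-homo-* a (suc e)) ⟨
      ℕtoℚ (a ℕ.* suc e) * (inv (suc b) * inv (suc e))      ∎
      where
      shuffle : ∀ x y z w → x * y * (z * w) ≡ x * w * (y * z)
      shuffle = solve-∀ ℚ-ring

  /≡÷ : ∀ a b → + a / suc b ≡ a ÷ suc b
  /≡÷ a b = toℚᵘ-injective (begin
    toℚᵘ (+ a / suc b)                          ≈⟨ toℚᵘ-fromℚᵘ (mkℚᵘ (+ a) b) ⟩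
    mkℚᵘ (+ a) b                                ≈⟨ *≡* (cross (+ a)) ⟩
    mkℚᵘ (+ a) 0 ℚᵘ.* mkℚᵘ (+ 1) b              ≡⟨ cong₂ ℚᵘ._*_ (toℚᵘ-ℕtoℚ a) (cong toℚᵘ (normalize-coprime (1-coprimeTo (suc b)))) ⟨
    toℚᵘ (ℕtoℚ a) ℚᵘ.* toℚᵘ (inv (suc b))       ≈⟨ toℚᵘ-homo-* (ℕtoℚ a) (inv (suc b)) ⟨
    toℚᵘ (a ÷ suc b)                            ∎)
    where
    open ℚᵘₚ.≃-Reasoning
    cross : ∀ x → x ℤ.* + suc (b ℕ.+ 0) ≡ (x ℤ.* + 1) ℤ.* + suc b
    cross x rewrite ℕₚ.+-identityʳ b | ℤₚ.*-identityʳ x = refl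

  open Sums +-0-isCommutativeMonoid
  module ℕ∑ = Sums ℕₚ.+-0-isCommutativeMonoid

  ∑-mono-≤ : ∀ t {f g} → (∀ i → i ℕ.< t → f i ≤ g i) → ∑ t f ≤ ∑ t g
  ∑-mono-≤ zero    f≤g = ≤-refl
  ∑-mono-≤ (suc t) f≤g = +-mono-≤ (f≤g 0 (ℕ.s≤s ℕ.z≤n)) (∑-mono-≤ t (λ i i<t → f≤g (suc i) (ℕ.s≤s i<t)))

  ∑-nonNeg : ∀ t {f} → (∀ i → i ℕ.< t → 0ℚ ≤ f i) → 0ℚ ≤ ∑ t f
  ∑-nonNeg zero    0≤f = ≤-refl
  ∑-nonNeg (suc t) 0≤f = +-mono-≤ (0≤f 0 (ℕ.s≤s ℕ.z≤n)) (∑-nonNeg t (λ i i<t → 0≤f (suc i) (ℕ.s≤s i<t)))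

  ℕtoℚ-∑ : ∀ t f → ℕtoℚ (ℕ∑.∑ t f) ≡ ∑ t (ℕtoℚ ∘ f)
  ℕtoℚ-∑ = ∑-homo ℕₚ.+-0-isCommutativeMonoid +-0-isCommutativeMonoid ℕtoℚ refl ℕtoℚ-homo-+

  *-distribʳ-∑ : ∀ c t f → ∑ t f * c ≡ ∑ t (λ i → f i * c)
  *-distribʳ-∑ c = ∑-homo +-0-isCommutativeMonoid +-0-isCommutativeMonoid (_* c) (*-zeroˡ c) (λ x y → *-distribʳ-+ c x y)

  neg-distrib-∑ : ∀ t f → - ∑ t f ≡ ∑ t (-_ ∘ f)
  neg-distrib-∑ = ∑-homo +-0-isCommutativeMonoid +-0-isCommutativeMonoid -_ refl neg-distrib-+

  ∑-sub : ∀ t f g → ∑ t (λ i → f i - g i) ≡ ∑ t f - ∑ t g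
  ∑-sub t f g = trans (∑-distrib t f (-_ ∘ g)) (cong (λ s → ∑ t f + s) (sym (neg-distrib-∑ t g)))

  ∑-const : ∀ t c → ∑ t (λ _ → c) ≡ ℕtoℚ t * c
  ∑-const zero    c = sym (*-zeroˡ c)
  ∑-const (suc t) c = begin
    c + ∑ t (λ _ → c)      ≡⟨ cong (λ s → c + s) (∑-const t c) ⟩
    c + ℕtoℚ t * c         ≡⟨ cong (_+ ℕtoℚ t * c) (*-identityˡ c) ⟨
    1ℚ * c + ℕtoℚ t * c    ≡⟨ *-distribʳ-+ c 1ℚ (ℕtoℚ t) ⟨
    (1ℚ + ℕtoℚ t) * c      ≡⟨ cong (_* c) (ℕtoℚ-homo-+ 1 t) ⟨
    ℕtoℚ (suc t) * c       ∎
    where open ≡-Reasoning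

module SummationByParts where
  open import Data.Nat.Base as ℕ using (_<_)
  import Data.Nat.Properties as ℕₚ
  open import Data.Rational.Base using (ℚ; 0ℚ; _+_; _-_; _*_; _≤_)
  open import Data.Rational.Properties
  open import Tactic.RingSolver using (solve-∀)
  open Rationals using (ℚ-ring)
  open Sums +-0-isCommutativeMonoid

  abel-≤ : ∀ T (y e : ℕ → ℚ) → (∀ t → t < T → 0ℚ ≤ (y t - y (suc t)) * ∑ (suc t) e) →
           y T * ∑ (suc T) e ≤ ∑ (suc T) (λ j → y j * e j)
  abel-≤ zero    y e _ = ≤-reflexive (trans (cong (y 0 *_) (+-identityʳ (e 0))) (sym (+-identityʳ _)))
  abel-≤ (suc T) y e H = begin
    y (suc T) * ∑ (suc (suc T)) e                      ≡⟨ cong (y (suc T) *_) (∑-last (suc T) e) ⟩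
    y (suc T) * (D + e (suc T))                        ≡⟨ parts (y T) (y (suc T)) D (e (suc T)) ⟩
    (y T * D + y (suc T) * e (suc T)) - (y T - y (suc T)) * D
                                                        ≤⟨ +-monoʳ-≤ (y T * D + y (suc T) * e (suc T)) (neg-antimono-≤ (H T (ℕₚ.n<1+n T))) ⟩
    (y T * D + y (suc T) * e (suc T)) - 0ℚ             ≡⟨ +-identityʳ _ ⟩
    y T * D + y (suc T) * e (suc T)                    ≤⟨ +-monoˡ-≤ _ (abel-≤ T y e (λ t t<T → H t (ℕₚ.m≤n⇒m≤1+n t<T))) ⟩
    ∑ (suc T) (λ j → y j * e j) + y (suc T) * e (suc T) ≡⟨ ∑-last (suc T) (λ j → y j * e j) ⟨
    ∑ (suc (suc T)) (λ j → y j * e j)                  ∎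
    where
    open ≤-Reasoning
    D : ℚ
    D = ∑ (suc T) e
    parts : ∀ a b d x → b * (d + x) ≡ (a * d + b * x) - (a - b) * d
    parts = solve-∀ ℚ-ring

module Binomial where
  open import Data.Nat.Base using (_+_; _*_; _^_; _≤_; _<_)
  open import Data.Nat.Properties
  open import Data.Nat.Combinatorics using (_C_; nCk+nC[k+1]≡[n+1]C[k+1]; k>n⇒nCk≡0; nCk≡nC[n∸k]; nC1≡n)
  open import Data.Nat.Tactic.RingSolver using (solve-∀)
  open import Data.Product using (_,_)
  open import Data.Sum using (inj₁; inj₂)
  open import Relation.Nullary using (yes; no)
  open Sums +-0-isCommutativeMonoid

  C-pascal : ∀ n k → suc n C suc k ≡ n C k + n C suc k
  C-pascal n k = sym (nCk+nC[k+1]≡[n+1]C[k+1] n k)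

  C-pos : ∀ {n k} → k ≤ n → 1 ≤ n C k
  C-pos {n}     {zero}  _         = ≤-refl
  C-pos {suc n} {suc k} (s≤s k≤n) rewrite C-pascal n k = ≤-trans (C-pos k≤n) (m≤m+n _ _)

  -- (k+1) C(n,k+1) = (n-k) C(n,k), with the subtraction moved across.
  C-absorb : ∀ n k → suc k * (n C suc k) + k * (n C k) ≡ n * (n C k)
  C-absorb n       zero    = trans (+-identityʳ (1 * (n C 1))) (trans (*-identityˡ (n C 1)) (trans (nC1≡n n) (sym (*-identityʳ n))))
  C-absorb zero    (suc k) = cong₂ _+_ (*-zeroʳ (suc (suc k))) (*-zeroʳ (suc k))
  C-absorb (suc n) (suc j) rewrite C-pascal n (suc j) | C-pascal n j = begin
    (2 + j) * (b₁ + b₂) + (1 + j) * (b₀ + b₁)                      ≡⟨ regroup j b₀ b₁ b₂ ⟩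
    ((2 + j) * b₂ + (1 + j) * b₁) + ((1 + j) * b₁ + j * b₀) + (b₁ + b₀) ≡⟨ cong₂ (λ x y → x + y + (b₁ + b₀)) (C-absorb n (suc j)) (C-absorb n j) ⟩
    n * b₁ + n * b₀ + (b₁ + b₀)                                    ≡⟨ collect n b₀ b₁ ⟩
    (1 + n) * (b₀ + b₁)                                            ∎
    where
    open ≡-Reasoning
    b₀ b₁ b₂ : ℕ
    b₀ = n C j
    b₁ = n C suc j
    b₂ = n C suc (suc j)
    regroup : ∀ j b₀ b₁ b₂ → (2 + j) * (b₁ + b₂) + (1 + j) * (b₀ + b₁) ≡ ((2 + j) * b₂ + (1 + j) * b₁) + ((1 + j) * b₁ + j * b₀) + (b₁ + b₀)
    regroup = solve-∀
    collect : ∀ n b₀ b₁ → n * b₁ + n * b₀ + (b₁ + b₀) ≡ (1 + n) * (b₀ + b₁)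
    collect = solve-∀

  C-suc-suc : ∀ n k → suc k * (suc n C suc k) ≡ suc n * (n C k)
  C-suc-suc n k rewrite C-pascal n k = begin
    suc k * (n C k + n C suc k)                      ≡⟨ regroup k (n C k) (n C suc k) ⟩
    (suc k * (n C suc k) + k * (n C k)) + n C k      ≡⟨ cong (_+ n C k) (C-absorb n k) ⟩
    n * (n C k) + n C k                              ≡⟨ +-comm (n * (n C k)) (n C k) ⟩
    suc n * (n C k)                                  ∎
    where
    open ≡-Reasoning
    regroup : ∀ k a b → suc k * (a + b) ≡ (suc k * b + k * a) + a
    regroup = solve-∀

  -- (n+1-k) C(n+1,k) = (n+1) C(n,k), with the subtraction moved across.
  C-suc : ∀ n k → k * (suc n C k) + suc n * (n C k) ≡ suc n * (suc n C k)
  C-suc n zero    = refl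
  C-suc n (suc k) = begin
    suc k * (suc n C suc k) + suc n * (n C suc k) ≡⟨ cong (_+ suc n * (n C suc k)) (C-suc-suc n k) ⟩
    suc n * (n C k) + suc n * (n C suc k)         ≡⟨ *-distribˡ-+ (suc n) (n C k) (n C suc k) ⟨
    suc n * (n C k + n C suc k)                   ≡⟨ cong (suc n *_) (C-pascal n k) ⟨
    suc n * (suc n C suc k)                       ∎
    where open ≡-Reasoning

  C-sym : ∀ i r → (i + r) C i ≡ (i + r) C r
  C-sym i r = trans (nCk≡nC[n∸k] (m≤m+n i r)) (cong ((i + r) C_) (m+n∸m≡n i r))

  C-ratio : ∀ {n i} r → suc i * r + i ≤ n → r * (n C i) ≤ n C suc i
  C-ratio {n} {i} r h = *-cancelˡ-≤ (suc i) (+-cancelʳ-≤ (i * (n C i)) _ _ (begin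
    suc i * (r * (n C i)) + i * (n C i)   ≡⟨ collect (suc i) r i (n C i) ⟩
    (suc i * r + i) * (n C i)             ≤⟨ *-monoˡ-≤ (n C i) h ⟩
    n * (n C i)                           ≡⟨ C-absorb n i ⟨
    suc i * (n C suc i) + i * (n C i)     ∎))
    where
    open ≤-Reasoning
    collect : ∀ a r i c → a * (r * c) + i * c ≡ (a * r + i) * c
    collect = solve-∀

  C-mono-≤ : ∀ {n i j} → i ≤ j → 2 * j ≤ suc n → n C i ≤ n C j
  C-mono-≤ {j = zero}  z≤n _ = ≤-refl
  C-mono-≤ {n} {i} {suc j} i≤1+j 2j+2≤n+1 with m≤n⇒m<n∨m≡n i≤1+j
  ... | inj₂ refl      = ≤-refl
  ... | inj₁ (s≤s i≤j) = ≤-trans (C-mono-≤ i≤j (≤-trans (*-monoʳ-≤ 2 (n≤1+n j)) 2j+2≤n+1))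
                                 (subst (_≤ n C suc j) (*-identityˡ (n C j)) (C-ratio 1 2j+1≤n))
    where
    two-steps : ∀ j → suc (suc j * 1 + j) ≡ 2 * suc j
    two-steps = solve-∀
    2j+1≤n : suc j * 1 + j ≤ n
    2j+1≤n = ≤-pred (≤-trans (≤-reflexive (two-steps j)) 2j+2≤n+1)

  private
    double-≤ : ∀ {x y} → x ≤ y → 2 * x ≤ suc (x + y)
    double-≤ {x} {y} x≤y = ≤-trans (≤-reflexive (cong (x +_) (+-identityʳ x))) (≤-trans (+-monoʳ-≤ x x≤y) (n≤1+n (x + y)))

  C-≤-inner : ∀ {n ℓ i} → ℓ ≤ i → i + ℓ ≤ n → n C ℓ ≤ n C i
  C-≤-inner {n} {ℓ} {i} ℓ≤i i+ℓ≤n with m≤n⇒∃[o]m+o≡n (≤-trans (m≤m+n i ℓ) i+ℓ≤n)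
  ... | r , refl with ≤-total i r
  ...   | inj₁ i≤r = C-mono-≤ ℓ≤i (double-≤ i≤r)
  ...   | inj₂ r≤i = subst ((i + r) C ℓ ≤_) (sym (C-sym i r))
                       (C-mono-≤ (+-cancelˡ-≤ i ℓ r i+ℓ≤n) (subst (λ m → 2 * r ≤ suc m) (+-comm r i) (double-≤ r≤i)))

  C-outer-≤ : ∀ {n ℓ i} → 2 * ℓ ≤ suc n → n ≤ i + ℓ → n C i ≤ n C ℓ
  C-outer-≤ {n} {ℓ} {i} 2ℓ≤n+1 n≤i+ℓ with i ≤? n
  ... | no  i≰n = subst (_≤ n C ℓ) (sym (k>n⇒nCk≡0 (≰⇒> i≰n))) z≤n
  ... | yes i≤n with m≤n⇒∃[o]m+o≡n i≤n
  ...   | r , refl = subst (_≤ (i + r) C ℓ) (sym (C-sym i r)) (C-mono-≤ (+-cancelˡ-≤ i r ℓ n≤i+ℓ) 2ℓ≤n+1)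

  C-row-sum : ∀ n → ∑ (suc n) (n C_) ≡ 2 ^ n
  C-row-sum zero    = refl
  C-row-sum (suc n) = begin
    1 + ∑ (suc n) (λ i → suc n C suc i)      ≡⟨ cong (1 +_) (∑-cong (suc n) (λ i _ → C-pascal n i)) ⟩
    1 + ∑ (suc n) (λ i → n C i + n C suc i)  ≡⟨ cong (1 +_) (∑-distrib (suc n) (n C_) (λ i → n C suc i)) ⟩
    1 + (S + T)                              ≡⟨ +-comm 1 (S + T) ⟩
    S + T + 1                                ≡⟨ +-assoc S T 1 ⟩
    S + (T + 1)                              ≡⟨ cong (S +_) shifted ⟨
    S + S                                    ≡⟨ cong (λ s → s + s) (C-row-sum n) ⟩
    2 ^ n + 2 ^ n                            ≡⟨ cong (2 ^ n +_) (+-identityʳ (2 ^ n)) ⟨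
    2 * 2 ^ n                                ∎
    where
    open ≡-Reasoning
    S T : ℕ
    S = ∑ (suc n) (n C_)
    T = ∑ (suc n) (λ i → n C suc i)
    shifted : S ≡ T + 1
    shifted = begin
      S                           ≡⟨ +-identityʳ S ⟨
      S + 0                       ≡⟨ cong (S +_) (k>n⇒nCk≡0 (n<1+n n)) ⟨
      S + n C suc n               ≡⟨ ∑-last (suc n) (n C_) ⟨
      ∑ (suc (suc n)) (n C_)      ≡⟨ +-comm 1 T ⟩
      T + 1                       ∎

  -- Below n/3 the row at least doubles at each step, so it dominates its own prefix sums.
  C-prefix-sum-≤ : ∀ n k → 3 * k ≤ suc n → ∑ k (n C_) ≤ n C k
  C-prefix-sum-≤ n zero    _          = z≤n
  C-prefix-sum-≤ n (suc k) 3k+3≤n+1 = begin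
    ∑ (suc k) (n C_)          ≡⟨ ∑-last k (n C_) ⟩
    ∑ k (n C_) + n C k        ≤⟨ +-monoˡ-≤ (n C k) (C-prefix-sum-≤ n k (≤-trans (*-monoʳ-≤ 3 (n≤1+n k)) 3k+3≤n+1)) ⟩
    n C k + n C k             ≡⟨ cong (n C k +_) (+-identityʳ (n C k)) ⟨
    2 * (n C k)               ≤⟨ C-ratio 2 (≤-pred (≤-trans (≤-reflexive (three-steps k)) 3k+3≤n+1)) ⟩
    n C suc k                 ∎
    where
    open ≤-Reasoning
    three-steps : ∀ k → suc (suc k * 2 + k) ≡ 3 * suc k
    three-steps = solve-∀

module PartialSums where
  open import Data.Bool.Base using (T)
  open import Data.Nat.Base using (_+_; _*_; _^_; _≤_; _<_; _≤ᵇ_)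
  open import Data.Nat.Properties
  open import Data.Nat.Combinatorics using (_C_; nCn≡1; nC1≡n)
  open import Data.Nat.Tactic.RingSolver using (solve-∀)
  open import Data.Product using (_×_; _,_)
  open import Data.Sum using (inj₁; inj₂)
  open import Relation.Nullary using (¬_; yes; no)
  open Sums +-0-isCommutativeMonoid
  open NatSums
  open Binomial

  decide : ∀ {m n} {_ : T (m ≤ᵇ n)} → m ≤ n
  decide {m} {n} {m≤ᵇn} = ≤ᵇ⇒≤ m n m≤ᵇn

  MeanDominates : ℕ → ℕ → ℕ → Set
  MeanDominates n ℓ t = t * (n C ℓ) ≤ ∑ t (λ j → n C (ℓ + j))

  meanDominates-short : ∀ n ℓ t → 2 * ℓ + t ≤ suc n → MeanDominates n ℓ t
  meanDominates-short n ℓ t h = subst (_≤ ∑ t (λ j → n C (ℓ + j))) (∑-const t (n C ℓ))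
    (∑-mono-≤ t (λ j j<t → C-≤-inner (m≤m+n ℓ j) (inner j j<t)))
    where
    inner : ∀ j → j < t → ℓ + j + ℓ ≤ n
    inner j j<t = ≤-pred (begin
      suc (ℓ + j + ℓ)   ≡⟨ cong suc (rearrange ℓ j) ⟩
      suc (2 * ℓ + j)   ≡⟨ +-suc (2 * ℓ) j ⟨
      2 * ℓ + suc j     ≤⟨ +-monoʳ-≤ (2 * ℓ) j<t ⟩
      2 * ℓ + t         ≤⟨ h ⟩
      suc n             ∎)
      where
      open ≤-Reasoning
      rearrange : ∀ ℓ j → ℓ + j + ℓ ≡ 2 * ℓ + j
      rearrange = solve-∀

  -- Past the middle of the row the next term C(n, ℓ+t) falls below C(n, ℓ), so removing it keeps the mean above C(n, ℓ).
  meanDominates-pred : ∀ n ℓ t → 2 * ℓ ≤ suc n → MeanDominates n ℓ (suc t) → MeanDominates n ℓ t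
  meanDominates-pred n ℓ t 2ℓ≤n+1 md with 2 * ℓ + t ≤? suc n
  ... | yes short = meanDominates-short n ℓ t short
  ... | no  long  = +-cancelʳ-≤ (n C ℓ) _ _ (begin
    t * (n C ℓ) + n C ℓ                         ≡⟨ +-comm (t * (n C ℓ)) (n C ℓ) ⟩
    suc t * (n C ℓ)                             ≤⟨ md ⟩
    ∑ (suc t) (λ j → n C (ℓ + j))               ≡⟨ ∑-last t (λ j → n C (ℓ + j)) ⟩
    ∑ t (λ j → n C (ℓ + j)) + n C (ℓ + t)       ≤⟨ +-monoʳ-≤ (∑ t (λ j → n C (ℓ + j))) (C-outer-≤ {n} {ℓ} 2ℓ≤n+1 n≤ℓ+t+ℓ) ⟩
    ∑ t (λ j → n C (ℓ + j)) + n C ℓ             ∎)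
    where
    open ≤-Reasoning
    n≤ℓ+t+ℓ : n ≤ ℓ + t + ℓ
    n≤ℓ+t+ℓ = ≤-trans (≤-trans (n≤1+n n) (<⇒≤ (≰⇒> long))) (≤-reflexive (rearrange ℓ t))
      where
      rearrange : ∀ ℓ t → 2 * ℓ + t ≡ ℓ + t + ℓ
      rearrange = solve-∀

  meanDominates-≤ : ∀ n ℓ {t T} → 2 * ℓ ≤ suc n → MeanDominates n ℓ T → t ≤ T → MeanDominates n ℓ t
  meanDominates-≤ n ℓ {T = zero}  _       md z≤n = md
  meanDominates-≤ n ℓ {T = suc T} 2ℓ≤n+1 md t≤T with m≤n⇒m<n∨m≡n t≤T
  ... | inj₂ refl     = md
  ... | inj₁ (s≤s t≤T) = meanDominates-≤ n ℓ 2ℓ≤n+1 (meanDominates-pred n ℓ T 2ℓ≤n+1 md) t≤T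

  PowerBound : ℕ → ℕ → Set
  PowerBound ℓ a = (a + 1) * ((ℓ + a) C ℓ) + (ℓ + a) + 1 ≤ 2 ^ (ℓ + a)

  -- Split 2^n = ∑ C(n, ·) at ℓ: the part below ℓ is at most C(n, ℓ), and the last term C(n, n) is 1.
  powerBound⇒upper-sum : ∀ ℓ a → 3 * ℓ ≤ suc (ℓ + a) → PowerBound ℓ a →
                          a * ((ℓ + a) C ℓ) + (ℓ + a) ≤ ∑ a (λ j → (ℓ + a) C (ℓ + j))
  powerBound⇒upper-sum ℓ a 3ℓ≤n+1 bound = +-cancelˡ-≤ (n C ℓ) _ _ (+-cancelʳ-≤ 1 _ _ (begin
    n C ℓ + (a * (n C ℓ) + n) + 1              ≡⟨ collect (n C ℓ) a n ⟩
    (a + 1) * (n C ℓ) + n + 1                  ≤⟨ bound ⟩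
    2 ^ n                                      ≡⟨ C-row-sum n ⟨
    ∑ (suc n) (n C_)                           ≡⟨ cong (λ m → ∑ m (n C_)) (+-suc ℓ a) ⟨
    ∑ (ℓ + suc a) (n C_)                       ≡⟨ ∑-+ ℓ (suc a) (n C_) ⟩
    ∑ ℓ (n C_) + ∑ (suc a) upper               ≡⟨ cong (∑ ℓ (n C_) +_) (∑-last a upper) ⟩
    ∑ ℓ (n C_) + (∑ a upper + n C n)           ≡⟨ cong (λ c → ∑ ℓ (n C_) + (∑ a upper + c)) (nCn≡1 n) ⟩
    ∑ ℓ (n C_) + (∑ a upper + 1)               ≤⟨ +-monoˡ-≤ (∑ a upper + 1) (C-prefix-sum-≤ n ℓ 3ℓ≤n+1) ⟩
    n C ℓ + (∑ a upper + 1)                    ≡⟨ +-assoc (n C ℓ) (∑ a upper) 1 ⟨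
    n C ℓ + ∑ a upper + 1                      ∎))
    where
    open ≤-Reasoning
    n : ℕ
    n = ℓ + a
    upper : ℕ → ℕ
    upper j = n C (ℓ + j)
    collect : ∀ c a n → c + (a * c + n) + 1 ≡ (a + 1) * c + n + 1
    collect = solve-∀

  2ℓ≤a⇒3ℓ≤n+1 : ∀ {ℓ a} → 2 * ℓ ≤ a → 3 * ℓ ≤ suc (ℓ + a)
  2ℓ≤a⇒3ℓ≤n+1 {ℓ} {a} 2ℓ≤a = ≤-trans (≤-reflexive (split ℓ)) (≤-trans (+-monoʳ-≤ ℓ 2ℓ≤a) (n≤1+n (ℓ + a)))
    where
    split : ∀ ℓ → 3 * ℓ ≡ ℓ + 2 * ℓ
    split = solve-∀

  meanDominates-top : ∀ ℓ a → 2 * ℓ ≤ a → PowerBound ℓ a → MeanDominates (ℓ + a) ℓ a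
  meanDominates-top ℓ a 2ℓ≤a bound = ≤-trans (m≤m+n _ _) (powerBound⇒upper-sum ℓ a (2ℓ≤a⇒3ℓ≤n+1 2ℓ≤a) bound)

  -- Here the dropped last term C(n, n-1) is exactly the slack n.
  meanDominates-below-top : ∀ ℓ b → 2 * ℓ ≤ suc b → PowerBound ℓ (suc b) → MeanDominates (ℓ + suc b) ℓ b
  meanDominates-below-top ℓ b 2ℓ≤a bound = ≤-trans (*-monoˡ-≤ (n C ℓ) (n≤1+n b)) (+-cancelʳ-≤ n _ _ (begin
    suc b * (n C ℓ) + n                          ≤⟨ powerBound⇒upper-sum ℓ (suc b) (2ℓ≤a⇒3ℓ≤n+1 2ℓ≤a) bound ⟩
    ∑ (suc b) upper                              ≡⟨ ∑-last b upper ⟩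
    ∑ b upper + n C (ℓ + b)                      ≡⟨ cong (∑ b upper +_) n-1-choose ⟩
    ∑ b upper + n                                ∎))
    where
    open ≤-Reasoning
    n : ℕ
    n = ℓ + suc b
    upper : ℕ → ℕ
    upper j = n C (ℓ + j)
    n-1-choose : n C (ℓ + b) ≡ n
    n-1-choose = begin-equality
      n C (ℓ + b)         ≡⟨ cong (_C (ℓ + b)) (trans (+-suc ℓ b) (+-comm 1 (ℓ + b))) ⟩
      (ℓ + b + 1) C (ℓ + b) ≡⟨ C-sym (ℓ + b) 1 ⟩
      (ℓ + b + 1) C 1       ≡⟨ nC1≡n (ℓ + b + 1) ⟩
      ℓ + b + 1             ≡⟨ trans (+-comm (ℓ + b) 1) (sym (+-suc ℓ b)) ⟩
      n                     ∎

  -- The step a ↦ a + 1 doubles 2^n, while C(n, ℓ) grows by C(n, ℓ-1) ≤ a C(n, ℓ)/(a+2) since a ≥ 2ℓ.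
  powerBound-suc : ∀ k a → 2 * suc k ≤ a → PowerBound (suc k) a → PowerBound (suc k) (suc a)
  powerBound-suc k a 2ℓ≤a bound = begin
    (suc a + 1) * (n′ C suc k) + n′ + 1          ≡⟨ cong (λ m → (suc a + 1) * (m C suc k) + m + 1) n′≡1+n ⟩
    (suc a + 1) * (suc n C suc k) + suc n + 1    ≡⟨ cong (λ c → (suc a + 1) * c + suc n + 1) (C-pascal n k) ⟩
    (suc a + 1) * (u + v) + suc n + 1            ≡⟨ regroup a u v n ⟩
    (a + 2) * u + ((a + 2) * v + n + 2)          ≤⟨ +-monoˡ-≤ ((a + 2) * v + n + 2) lower≤ ⟩
    a * v + ((a + 2) * v + n + 2)                ≤⟨ m≤m+n _ n ⟩
    a * v + ((a + 2) * v + n + 2) + n            ≡⟨ double a v n ⟩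
    2 * ((a + 1) * v + n + 1)                    ≤⟨ *-monoʳ-≤ 2 bound ⟩
    2 ^ suc n                                    ≡⟨ cong (2 ^_) n′≡1+n ⟨
    2 ^ n′                                       ∎
    where
    open ≤-Reasoning
    n n′ : ℕ
    n = suc k + a
    n′ = suc k + suc a
    n′≡1+n : n′ ≡ suc n
    n′≡1+n = +-suc (suc k) a
    u v : ℕ
    u = n C k
    v = n C suc k
    ℓv≡[a+1]u : suc k * v ≡ (a + 1) * u
    ℓv≡[a+1]u = +-cancelʳ-≡ (k * u) _ _ (trans (C-absorb n k) (split k a u))
      where
      split : ∀ k a u → (suc k + a) * u ≡ (a + 1) * u + k * u
      split = solve-∀
    ℓ[a+2]≤a[a+1] : (a + 2) * suc k ≤ a * (a + 1)
    ℓ[a+2]≤a[a+1] = begin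
      (a + 2) * suc k          ≡⟨ expand a (suc k) ⟩
      a * suc k + 2 * suc k    ≤⟨ +-mono-≤ (*-monoʳ-≤ a (≤-trans (m≤m+n (suc k) _) 2ℓ≤a)) 2ℓ≤a ⟩
      a * a + a                ≡⟨ expand′ a ⟩
      a * (a + 1)              ∎
      where
      expand : ∀ a ℓ → (a + 2) * ℓ ≡ a * ℓ + 2 * ℓ
      expand = solve-∀
      expand′ : ∀ a → a * a + a ≡ a * (a + 1)
      expand′ = solve-∀
    lower≤ : (a + 2) * u ≤ a * v
    lower≤ = *-cancelˡ-≤ (suc k) (begin
      suc k * ((a + 2) * u)    ≡⟨ swap (suc k) (a + 2) u ⟩
      ((a + 2) * suc k) * u    ≤⟨ *-monoˡ-≤ u ℓ[a+2]≤a[a+1] ⟩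
      (a * (a + 1)) * u        ≡⟨ *-assoc a (a + 1) u ⟩
      a * ((a + 1) * u)        ≡⟨ cong (a *_) ℓv≡[a+1]u ⟨
      a * (suc k * v)          ≡⟨ swap′ a (suc k) v ⟩
      suc k * (a * v)          ∎)
      where
      swap : ∀ x y z → x * (y * z) ≡ (y * x) * z
      swap = solve-∀
      swap′ : ∀ x y z → x * (y * z) ≡ y * (x * z)
      swap′ = solve-∀
    regroup : ∀ a u v n → (suc a + 1) * (u + v) + suc n + 1 ≡ (a + 2) * u + ((a + 2) * v + n + 2)
    regroup = solve-∀
    double : ∀ a v n → a * v + ((a + 2) * v + n + 2) + n ≡ 2 * ((a + 1) * v + n + 1)
    double = solve-∀

  -- Along a = 2ℓ, C(3ℓ+3, ℓ+1)/C(3ℓ, ℓ) = 3(3ℓ+2)(3ℓ+1)/((2ℓ+2)(2ℓ+1)) grows more slowly than 2^3 (2ℓ+1)/(2ℓ+3) once ℓ ≥ 2.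
  powerBound-diagonal : ∀ ℓ → 2 ≤ ℓ → PowerBound ℓ (2 * ℓ) → PowerBound (suc ℓ) (2 * suc ℓ)
  powerBound-diagonal (suc zero)      (s≤s ()) _
  powerBound-diagonal ℓ@(suc (suc m)) _        bound = begin
    (2 * suc ℓ + 1) * (n′ C suc ℓ) + n′ + 1      ≡⟨ cong (λ k → (2 * suc ℓ + 1) * (k C suc ℓ) + k + 1) n′≡3+n ⟩
    (2 * suc ℓ + 1) * x₃ + (3 + n) + 1           ≡⟨ cong (λ c → c * x₃ + (3 + n) + 1) (coefficient ℓ) ⟩
    (2 * ℓ + 3) * x₃ + (3 + n) + 1               ≤⟨ +-monoˡ-≤ 1 (+-monoˡ-≤ (3 + n) x₃≤) ⟩
    8 * ((2 * ℓ + 1) * x₀) + (3 + n) + 1         ≤⟨ m≤m+n _ (7 * n + 4) ⟩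
    8 * ((2 * ℓ + 1) * x₀) + (3 + n) + 1 + (7 * n + 4) ≡⟨ collect ((2 * ℓ + 1) * x₀) n ⟩
    8 * ((2 * ℓ + 1) * x₀ + n + 1)               ≤⟨ *-monoʳ-≤ 8 bound ⟩
    8 * 2 ^ n                                    ≡⟨ cubed (2 ^ n) ⟩
    2 ^ (3 + n)                                  ≡⟨ cong (2 ^_) n′≡3+n ⟨
    2 ^ n′                                       ∎
    where
    open ≤-Reasoning
    n n′ : ℕ
    n = ℓ + 2 * ℓ
    n′ = suc ℓ + 2 * suc ℓ
    n′≡3+n : n′ ≡ 3 + n
    n′≡3+n = three-more ℓ
      where
      three-more : ∀ ℓ → suc ℓ + 2 * suc ℓ ≡ 3 + (ℓ + 2 * ℓ)
      three-more = solve-∀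
    x₀ x₁ x₂ x₃ : ℕ
    x₀ = n C ℓ
    x₁ = suc n C ℓ
    x₂ = suc (suc n) C ℓ
    x₃ = (3 + n) C suc ℓ
    x₃≡3x₂ : x₃ ≡ 3 * x₂
    x₃≡3x₂ = *-cancelˡ-≡ x₃ (3 * x₂) (suc ℓ) (trans (C-suc-suc (suc (suc n)) ℓ) (e ℓ x₂))
      where
      e : ∀ ℓ x → (3 + (ℓ + 2 * ℓ)) * x ≡ suc ℓ * (3 * x)
      e = solve-∀
    [2ℓ+2]x₂≡[3ℓ+2]x₁ : (2 * ℓ + 2) * x₂ ≡ (3 * ℓ + 2) * x₁
    [2ℓ+2]x₂≡[3ℓ+2]x₁ = +-cancelˡ-≡ (ℓ * x₂) _ _ (trans (e ℓ x₂) (trans (sym (C-suc (suc n) ℓ)) (cong (ℓ * x₂ +_) (e′ ℓ x₁))))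
      where
      e : ∀ ℓ x → ℓ * x + (2 * ℓ + 2) * x ≡ (2 + (ℓ + 2 * ℓ)) * x
      e = solve-∀
      e′ : ∀ ℓ x → (2 + (ℓ + 2 * ℓ)) * x ≡ (3 * ℓ + 2) * x
      e′ = solve-∀
    [2ℓ+1]x₁≡[3ℓ+1]x₀ : (2 * ℓ + 1) * x₁ ≡ (3 * ℓ + 1) * x₀
    [2ℓ+1]x₁≡[3ℓ+1]x₀ = +-cancelˡ-≡ (ℓ * x₁) _ _ (trans (e ℓ x₁) (trans (sym (C-suc n ℓ)) (cong (ℓ * x₁ +_) (e′ ℓ x₀))))
      where
      e : ∀ ℓ x → ℓ * x + (2 * ℓ + 1) * x ≡ (1 + (ℓ + 2 * ℓ)) * x
      e = solve-∀
      e′ : ∀ ℓ x → (1 + (ℓ + 2 * ℓ)) * x ≡ (3 * ℓ + 1) * x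
      e′ = solve-∀
    K : ℕ
    K = (2 * ℓ + 2) * (2 * ℓ + 1)
    x₃≤ : (2 * ℓ + 3) * x₃ ≤ 8 * ((2 * ℓ + 1) * x₀)
    x₃≤ = *-cancelˡ-≤ K (begin
      K * ((2 * ℓ + 3) * x₃)                              ≡⟨ cong (λ x → K * ((2 * ℓ + 3) * x)) x₃≡3x₂ ⟩
      K * ((2 * ℓ + 3) * (3 * x₂))                        ≡⟨ e₁ ℓ x₂ ⟩
      3 * (2 * ℓ + 3) * (2 * ℓ + 1) * ((2 * ℓ + 2) * x₂)  ≡⟨ cong (3 * (2 * ℓ + 3) * (2 * ℓ + 1) *_) [2ℓ+2]x₂≡[3ℓ+2]x₁ ⟩
      3 * (2 * ℓ + 3) * (2 * ℓ + 1) * ((3 * ℓ + 2) * x₁)  ≡⟨ e₂ ℓ x₁ ⟩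
      3 * (2 * ℓ + 3) * (3 * ℓ + 2) * ((2 * ℓ + 1) * x₁)  ≡⟨ cong (3 * (2 * ℓ + 3) * (3 * ℓ + 2) *_) [2ℓ+1]x₁≡[3ℓ+1]x₀ ⟩
      3 * (2 * ℓ + 3) * (3 * ℓ + 2) * ((3 * ℓ + 1) * x₀)  ≤⟨ m≤m+n _ _ ⟩
      3 * (2 * ℓ + 3) * (3 * ℓ + 2) * ((3 * ℓ + 1) * x₀) + (10 * m * m * m + 53 * m * m + 79 * m + 24) * x₀ ≡⟨ e₃ m x₀ ⟩
      K * (8 * ((2 * ℓ + 1) * x₀))                        ∎)
      where
      e₁ : ∀ ℓ x → (2 * ℓ + 2) * (2 * ℓ + 1) * ((2 * ℓ + 3) * (3 * x)) ≡ 3 * (2 * ℓ + 3) * (2 * ℓ + 1) * ((2 * ℓ + 2) * x)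
      e₁ = solve-∀
      e₂ : ∀ ℓ x → 3 * (2 * ℓ + 3) * (2 * ℓ + 1) * ((3 * ℓ + 2) * x) ≡ 3 * (2 * ℓ + 3) * (3 * ℓ + 2) * ((2 * ℓ + 1) * x)
      e₂ = solve-∀
      e₃ : ∀ m x → 3 * (2 * (2 + m) + 3) * (3 * (2 + m) + 2) * ((3 * (2 + m) + 1) * x) + (10 * m * m * m + 53 * m * m + 79 * m + 24) * x
                 ≡ (2 * (2 + m) + 2) * (2 * (2 + m) + 1) * (8 * ((2 * (2 + m) + 1) * x))
      e₃ = solve-∀
    collect : ∀ x n → 8 * x + (3 + n) + 1 + (7 * n + 4) ≡ 8 * (x + n + 1)
    collect = solve-∀
    cubed : ∀ x → 8 * x ≡ 2 * (2 * (2 * x))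
    cubed = solve-∀
    coefficient : ∀ ℓ → 2 * suc ℓ + 1 ≡ 2 * ℓ + 3
    coefficient = solve-∀

  powerBound-+ : ∀ k a → 2 * suc k ≤ a → PowerBound (suc k) a → ∀ d → PowerBound (suc k) (a + d)
  powerBound-+ k a 2ℓ≤a bound zero    = subst (PowerBound (suc k)) (sym (+-identityʳ a)) bound
  powerBound-+ k a 2ℓ≤a bound (suc d) = subst (PowerBound (suc k)) (sym (+-suc a d))
    (powerBound-suc k (a + d) (≤-trans 2ℓ≤a (m≤m+n a d)) (powerBound-+ k a 2ℓ≤a bound d))

  powerBound-≥ : ∀ k {a₀ a} → 2 * suc k ≤ a₀ → PowerBound (suc k) a₀ → a₀ ≤ a → PowerBound (suc k) a
  powerBound-≥ k {a₀} 2ℓ≤a₀ bound a₀≤a with m≤n⇒∃[o]m+o≡n a₀≤a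
  ... | d , refl = powerBound-+ k a₀ 2ℓ≤a₀ bound d

  powerBound-diagonal-6+ : ∀ m → PowerBound (6 + m) (2 * (6 + m))
  powerBound-diagonal-6+ zero    = decide
  powerBound-diagonal-6+ (suc m) = powerBound-diagonal (6 + m) (≤-trans decide (m≤m+n 6 m)) (powerBound-diagonal-6+ m)

  powerBound-large : ∀ ℓ a → 6 ≤ ℓ → 2 * ℓ ≤ a → PowerBound ℓ a
  powerBound-large ℓ a 6≤ℓ 2ℓ≤a with m≤n⇒∃[o]m+o≡n 6≤ℓ
  ... | m , refl = powerBound-≥ (5 + m) ≤-refl (powerBound-diagonal-6+ m) 2ℓ≤a

  Exceptional : ℕ → ℕ → Set
  Exceptional n ℓ = n ≡ 3 * ℓ × 2 ≤ ℓ × ℓ ≤ 5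

  off-diagonal : ∀ ℓ a → 2 ≤ ℓ → ℓ ≤ 5 → 2 * ℓ ≤ a → ¬ Exceptional (ℓ + a) ℓ → suc (2 * ℓ) ≤ a
  off-diagonal ℓ a 2≤ℓ ℓ≤5 2ℓ≤a unexceptional = ≤∧≢⇒< 2ℓ≤a λ 2ℓ≡a →
    unexceptional (trans (cong (ℓ +_) (sym 2ℓ≡a)) (triple ℓ) , 2≤ℓ , ℓ≤5)
    where
    triple : ∀ ℓ → ℓ + 2 * ℓ ≡ 3 * ℓ
    triple = solve-∀

  -- For 2 ≤ ℓ ≤ 5 the power bound only starts at a = 2ℓ + 1 (at a = 6 for ℓ = 2); the values of a below
  -- that are either exceptional or checked directly.
  meanDominates-perfect : ∀ ℓ a → 2 * ℓ ≤ a → ¬ Exceptional (ℓ + a) ℓ → MeanDominates (ℓ + a) ℓ a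
  meanDominates-perfect 0 a _ _ = meanDominates-short (0 + a) 0 a (n≤1+n a)
  meanDominates-perfect 1 a _ _ = meanDominates-short (1 + a) 1 a ≤-refl
  meanDominates-perfect 2 a 4≤a unexceptional with a ≟ 5
  ... | yes refl = decide
  ... | no  a≢5  = meanDominates-top 2 a 4≤a (powerBound-≥ 1 decide decide
                     (≤∧≢⇒< (off-diagonal 2 a decide decide 4≤a unexceptional) (a≢5 ∘ sym)))
  meanDominates-perfect 3 a 6≤a unexceptional =
    meanDominates-top 3 a 6≤a (powerBound-≥ 2 decide decide (off-diagonal 3 a decide decide 6≤a unexceptional))
  meanDominates-perfect 4 a 8≤a unexceptional =
    meanDominates-top 4 a 8≤a (powerBound-≥ 3 decide decide (off-diagonal 4 a decide decide 8≤a unexceptional))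
  meanDominates-perfect 5 a 10≤a unexceptional =
    meanDominates-top 5 a 10≤a (powerBound-≥ 4 decide decide (off-diagonal 5 a decide decide 10≤a unexceptional))
  meanDominates-perfect ℓ@(suc (suc (suc (suc (suc (suc k)))))) a 2ℓ≤a _ =
    meanDominates-top ℓ a 2ℓ≤a (powerBound-large ℓ a (m≤m+n 6 k) 2ℓ≤a)

  meanDominates-below-top-small : ∀ k b → 2 * suc k ≤ suc b → PowerBound (suc k) (suc (2 * suc k)) →
                                (suc b ≡ 2 * suc k → MeanDominates (suc k + suc b) (suc k) b) →
                                MeanDominates (suc k + suc b) (suc k) b
  meanDominates-below-top-small k b 2ℓ≤1+b bound on-diagonal with suc b ≟ 2 * suc k
  ... | yes 1+b≡2ℓ = on-diagonal 1+b≡2ℓ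
  ... | no  1+b≢2ℓ = meanDominates-below-top (suc k) b 2ℓ≤1+b (powerBound-≥ k (n≤1+n _) bound (≤∧≢⇒< 2ℓ≤1+b (1+b≢2ℓ ∘ sym)))

  meanDominates-quasi : ∀ ℓ b → 2 * ℓ ≤ suc b → MeanDominates (ℓ + suc b) ℓ b
  meanDominates-quasi 0 b _ = meanDominates-short (0 + suc b) 0 b (≤-trans (n≤1+n b) (n≤1+n (suc b)))
  meanDominates-quasi 1 b _ = meanDominates-short (1 + suc b) 1 b (n≤1+n (suc (suc b)))
  meanDominates-quasi 2 b _ = meanDominates-short (2 + suc b) 2 b ≤-refl
  meanDominates-quasi 3 b h = meanDominates-below-top-small 2 b h decide λ { refl → decide }
  meanDominates-quasi 4 b h = meanDominates-below-top-small 3 b h decide λ { refl → decide }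
  meanDominates-quasi 5 b h = meanDominates-below-top-small 4 b h decide λ { refl → decide }
  meanDominates-quasi ℓ@(suc (suc (suc (suc (suc (suc k)))))) b 2ℓ≤a =
    meanDominates-below-top ℓ b 2ℓ≤a (powerBound-large ℓ (suc b) (m≤m+n 6 k) 2ℓ≤a)

module Layers where
  open import Data.Bool.Base using (true; false; if_then_else_)
  open import Data.Bool.Properties using () renaming (_≟_ to _≟ᵇ_)
  open import Data.List.Base using (List; []; _∷_; map; _++_; filter; foldr; length)
  open import Data.Vec.Base using ([]; _∷_)
  open import Data.Fin.Subset using (Subset; ∣_∣; inside; outside)
  open import Data.Nat.Base as ℕ using (_<_)
  open import Data.Nat.Combinatorics using (_C_)
  import Data.Nat.Properties as ℕₚ
  open import Data.Rational.Base using (ℚ; 0ℚ; 1ℚ; _+_; _*_)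
  open import Data.Rational.Properties
  open Rationals
  open Sums +-0-isCommutativeMonoid

  deletion : ∀ {n} → Family (suc n) → Family n
  deletion F s = F (outside ∷ s)

  link : ∀ {n} → Family (suc n) → Family n
  link F s = F (inside ∷ s)

  -- layer F i is the number of i-element members of F; a set avoiding the first point is
  -- counted in the deletion, a set containing it (minus that point) in the link.
  layer : ∀ {n} → Family n → ℕ → ℕ
  layer {zero}  F zero    = if F [] then 1 else 0
  layer {zero}  F (suc i) = 0
  layer {suc n} F zero    = layer (deletion F) zero
  layer {suc n} F (suc i) = layer (deletion F) (suc i) ℕ.+ layer (link F) i

  layer-vanish : ∀ {n} (F : Family n) {i} → n < i → layer F i ≡ 0
  layer-vanish {zero}  F {suc i} _         = refl
  layer-vanish {suc n} F {suc i} (ℕ.s≤s n<i) =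
    cong₂ ℕ._+_ (layer-vanish (deletion F) (ℕₚ.m≤n⇒m≤1+n n<i)) (layer-vanish (link F) n<i)

  sumOver : ∀ {m} → Family m → (Subset m → ℚ) → List (Subset m) → ℚ
  sumOver F w []      = 0ℚ
  sumOver F w (s ∷ L) = if F s then w s + sumOver F w L else sumOver F w L

  sumOver-filter : ∀ {m} (F : Family m) w L →
                   foldr (λ s acc → w s + acc) 0ℚ (filter (λ s → F s ≟ᵇ true) L) ≡ sumOver F w L
  sumOver-filter F w []      = refl
  sumOver-filter F w (s ∷ L) with F s
  ... | true  = cong (w s +_) (sumOver-filter F w L)
  ... | false = sumOver-filter F w L

  sumOver-++ : ∀ {m} (F : Family m) w L L′ → sumOver F w (L ++ L′) ≡ sumOver F w L + sumOver F w L′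
  sumOver-++ F w []      L′ = sym (+-identityˡ _)
  sumOver-++ F w (s ∷ L) L′ with F s
  ... | true  = trans (cong (w s +_) (sumOver-++ F w L L′)) (sym (+-assoc (w s) _ _))
  ... | false = sumOver-++ F w L L′

  sumOver-map : ∀ {m k} (F : Family m) w (h : Subset k → Subset m) L →
                sumOver F w (map h L) ≡ sumOver (F ∘ h) (w ∘ h) L
  sumOver-map F w h []      = refl
  sumOver-map F w h (s ∷ L) with F (h s)
  ... | true  = cong (w (h s) +_) (sumOver-map F w h L)
  ... | false = sumOver-map F w h L

  sumOver-layers : ∀ n (F : Family n) (g : ℕ → ℚ) →
                   sumOver F (g ∘ ∣_∣) (allSubsets n) ≡ ∑ (suc n) (λ i → ℕtoℚ (layer F i) * g i)
  sumOver-layers zero    F g with F []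
  ... | true  = cong (_+ 0ℚ) (sym (*-identityˡ (g 0)))
  ... | false = sym (trans (+-identityʳ _) (*-zeroˡ (g 0)))
  sumOver-layers (suc n) F g = begin
    sumOver F (g ∘ ∣_∣) (map (outside ∷_) L ++ map (inside ∷_) L)
      ≡⟨ sumOver-++ F (g ∘ ∣_∣) (map (outside ∷_) L) _ ⟩
    sumOver F (g ∘ ∣_∣) (map (outside ∷_) L) + sumOver F (g ∘ ∣_∣) (map (inside ∷_) L)
      ≡⟨ cong₂ _+_ (sumOver-map F _ (outside ∷_) L) (sumOver-map F _ (inside ∷_) L) ⟩
    sumOver (deletion F) (g ∘ ∣_∣) L + sumOver (link F) (g ∘ suc ∘ ∣_∣) L
      ≡⟨ cong₂ _+_ (sumOver-layers n (deletion F) g) (sumOver-layers n (link F) (g ∘ suc)) ⟩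
    ∑ (suc n) A + ∑ (suc n) B
      ≡⟨ cong (_+ ∑ (suc n) B) A-top ⟩
    (A 0 + ∑ (suc n) (A ∘ suc)) + ∑ (suc n) B
      ≡⟨ +-assoc (A 0) _ _ ⟩
    A 0 + (∑ (suc n) (A ∘ suc) + ∑ (suc n) B)
      ≡⟨ cong (A 0 +_) (∑-distrib (suc n) (A ∘ suc) B) ⟨
    A 0 + ∑ (suc n) (λ i → A (suc i) + B i)
      ≡⟨ cong (A 0 +_) (∑-cong (suc n) (λ i _ → split i)) ⟩
    A 0 + ∑ (suc n) (λ i → ℕtoℚ (layer F (suc i)) * g (suc i))
      ∎
    where
    open ≡-Reasoning
    L : List (Subset n)
    L = allSubsets n
    A : ℕ → ℚ
    A i = ℕtoℚ (layer (deletion F) i) * g i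
    B : ℕ → ℚ
    B i = ℕtoℚ (layer (link F) i) * g (suc i)
    A-top : ∑ (suc n) A ≡ A 0 + ∑ (suc n) (A ∘ suc)
    A-top = begin
      ∑ (suc n) A                           ≡⟨ +-identityʳ _ ⟨
      ∑ (suc n) A + 0ℚ                      ≡⟨ cong (∑ (suc n) A +_) A-last ⟨
      ∑ (suc n) A + A (suc n)               ≡⟨ ∑-last (suc n) A ⟨
      ∑ (suc (suc n)) A                     ∎
      where
      A-last : A (suc n) ≡ 0ℚ
      A-last = trans (cong (λ k → ℕtoℚ k * g (suc n)) (layer-vanish (deletion F) (ℕₚ.n<1+n n))) (*-zeroˡ (g (suc n)))
    split : ∀ i → A (suc i) + B i ≡ ℕtoℚ (layer F (suc i)) * g (suc i)
    split i = trans (sym (*-distribʳ-+ (g (suc i)) (ℕtoℚ (layer (deletion F) (suc i))) (ℕtoℚ (layer (link F) i))))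
                    (cong (_* g (suc i)) (sym (ℕtoℚ-homo-+ (layer (deletion F) (suc i)) (layer (link F) i))))

  norm-layers : ∀ {n} (F : Family n) → norm F ≡ ∑ (suc n) (λ i → layer F i ÷ (n C i))
  norm-layers {n} F = trans (sumOver-filter F _ (allSubsets n)) (sumOver-layers n F (λ i → inv (n C i)))

  card-layers : ∀ {n} (F : Family n) → ℕtoℚ (card F) ≡ ∑ (suc n) (ℕtoℚ ∘ layer F)
  card-layers {n} F = begin
    ℕtoℚ (card F)                                         ≡⟨ ℕtoℚ-length (members F) ⟩
    foldr (λ s acc → 1ℚ + acc) 0ℚ (members F)             ≡⟨ sumOver-filter F _ (allSubsets n) ⟩
    sumOver F (λ _ → 1ℚ) (allSubsets n)                   ≡⟨ sumOver-layers n F (λ _ → 1ℚ) ⟩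
    ∑ (suc n) (λ i → ℕtoℚ (layer F i) * 1ℚ)               ≡⟨ ∑-cong (suc n) (λ i _ → *-identityʳ (ℕtoℚ (layer F i))) ⟩
    ∑ (suc n) (ℕtoℚ ∘ layer F)                            ∎
    where
    open ≡-Reasoning
    ℕtoℚ-length : ∀ {m} (L : List (Subset m)) → ℕtoℚ (length L) ≡ foldr (λ s acc → 1ℚ + acc) 0ℚ L
    ℕtoℚ-length []      = refl
    ℕtoℚ-length (s ∷ L) = trans (ℕtoℚ-homo-+ 1 (length L)) (cong (1ℚ +_) (ℕtoℚ-length L))

module Complexes where
  open import Data.Bool.Base using (true; false)
  open import Data.Vec.Base using ([]; _∷_; here; there)
  open import Data.Fin.Subset using (inside; outside)
  open import Data.Nat.Base using (_+_; _*_; _≤_; _<_)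
  open import Data.Nat.Properties
  open import Data.Nat.Combinatorics using (_C_)
  open import Data.Nat.Tactic.RingSolver using (solve-∀)
  open import Relation.Nullary using (yes; no; contradiction)
  open Binomial using (C-pascal; C-absorb)
  open Layers

  deletion-complex : ∀ {n} {F : Family (suc n)} → IsComplex F → IsComplex (deletion F)
  deletion-complex cx E G E⊆G = cx (outside ∷ E) (outside ∷ G) λ { (there x∈E) → there (E⊆G x∈E) }

  link-complex : ∀ {n} {F : Family (suc n)} → IsComplex F → IsComplex (link F)
  link-complex cx E G E⊆G = cx (inside ∷ E) (inside ∷ G) λ { here → here ; (there x∈E) → there (E⊆G x∈E) }

  link⊆deletion : ∀ {n} {F : Family (suc n)} → IsComplex F → ∀ s → link F s ≡ true → deletion F s ≡ true
  link⊆deletion cx s = cx (outside ∷ s) (inside ∷ s) λ { (there x∈s) → there x∈s }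

  layer-mono : ∀ {n} {G H : Family n} → (∀ s → G s ≡ true → H s ≡ true) → ∀ i → layer G i ≤ layer H i
  layer-mono {zero} {G} {H} G⊆H zero with G [] | H [] | G⊆H []
  ... | true  | true  | _     = ≤-refl
  ... | true  | false | G⊆H₀ with () ← G⊆H₀ refl
  ... | false | _     | _     = z≤n
  layer-mono {zero}  G⊆H (suc i) = z≤n
  layer-mono {suc n} G⊆H zero    = layer-mono (λ s → G⊆H (outside ∷ s)) zero
  layer-mono {suc n} G⊆H (suc i) = +-mono-≤ (layer-mono (λ s → G⊆H (outside ∷ s)) (suc i)) (layer-mono (λ s → G⊆H (inside ∷ s)) i)

  layer-≤-C : ∀ {n} (F : Family n) i → layer F i ≤ n C i
  layer-≤-C {zero}  F zero with F []
  ... | true  = ≤-refl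
  ... | false = z≤n
  layer-≤-C {zero}  F (suc i) = z≤n
  layer-≤-C {suc n} F zero    = layer-≤-C (deletion F) zero
  layer-≤-C {suc n} F (suc i) = subst (layer F (suc i) ≤_) (trans (+-comm (n C suc i) (n C i)) (sym (C-pascal n i)))
    (+-mono-≤ (layer-≤-C (deletion F) (suc i)) (layer-≤-C (link F) i))

  layer-deletion-≤ : ∀ {n} (F : Family (suc n)) i → layer (deletion F) i ≤ layer F i
  layer-deletion-≤ F zero    = ≤-refl
  layer-deletion-≤ F (suc i) = m≤m+n _ _

  -- The local LYM inequality (i+1) f_{i+1} ≤ (n-i) f_i, with the subtraction moved across.
  local-LYM : ∀ {n} (F : Family n) → IsComplex F → ∀ i → suc i * layer F (suc i) + i * layer F i ≤ n * layer F i
  local-LYM {zero}  F cx zero    = z≤n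
  local-LYM {zero}  F cx (suc i) = ≤-reflexive (cong₂ _+_ (*-zeroʳ (suc (suc i))) (*-zeroʳ (suc i)))
  local-LYM {suc n} F cx zero    = begin
    1 * (a₁ + b₀) + 0 * a₀             ≡⟨ regroup a₀ a₁ b₀ ⟩
    (1 * a₁ + 0 * a₀) + b₀             ≤⟨ +-mono-≤ (local-LYM (deletion F) (deletion-complex cx) 0) b₀≤a₀ ⟩
    n * a₀ + a₀                        ≡⟨ +-comm (n * a₀) a₀ ⟩
    suc n * a₀                         ∎
    where
    open ≤-Reasoning
    a₀ a₁ b₀ : ℕ
    a₀ = layer (deletion F) 0
    a₁ = layer (deletion F) 1
    b₀ = layer (link F) 0
    b₀≤a₀ : b₀ ≤ a₀
    b₀≤a₀ = layer-mono (link⊆deletion cx) 0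
    regroup : ∀ a₀ a₁ b₀ → 1 * (a₁ + b₀) + 0 * a₀ ≡ (1 * a₁ + 0 * a₀) + b₀
    regroup = solve-∀
  local-LYM {suc n} F cx (suc j) = begin
    (2 + j) * (a₂ + b₁) + (1 + j) * (a₁ + b₀)                                   ≡⟨ regroup j a₁ a₂ b₀ b₁ ⟩
    ((2 + j) * a₂ + (1 + j) * a₁) + ((1 + j) * b₁ + j * b₀) + (b₁ + b₀)         ≤⟨ +-mono-≤ (+-mono-≤ deletion-LYM link-LYM) (+-monoˡ-≤ b₀ b₁≤a₁) ⟩
    n * a₁ + n * b₀ + (a₁ + b₀)                                                 ≡⟨ collect n a₁ b₀ ⟩
    (1 + n) * (a₁ + b₀)                                                         ∎
    where
    open ≤-Reasoning
    a₁ a₂ b₀ b₁ : ℕ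
    a₁ = layer (deletion F) (suc j)
    a₂ = layer (deletion F) (suc (suc j))
    b₀ = layer (link F) j
    b₁ = layer (link F) (suc j)
    deletion-LYM : (2 + j) * a₂ + (1 + j) * a₁ ≤ n * a₁
    deletion-LYM = local-LYM (deletion F) (deletion-complex cx) (suc j)
    link-LYM : (1 + j) * b₁ + j * b₀ ≤ n * b₀
    link-LYM = local-LYM (link F) (link-complex cx) j
    b₁≤a₁ : b₁ ≤ a₁
    b₁≤a₁ = layer-mono (link⊆deletion cx) (suc j)
    regroup : ∀ j a₁ a₂ b₀ b₁ → (2 + j) * (a₂ + b₁) + (1 + j) * (a₁ + b₀) ≡ ((2 + j) * a₂ + (1 + j) * a₁) + ((1 + j) * b₁ + j * b₀) + (b₁ + b₀)
    regroup = solve-∀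
    collect : ∀ n a₁ b₀ → n * a₁ + n * b₀ + (a₁ + b₀) ≡ (1 + n) * (a₁ + b₀)
    collect = solve-∀

  layer-ratio : ∀ {n} (F : Family n) → IsComplex F → ∀ i → layer F (suc i) * (n C i) ≤ layer F i * (n C suc i)
  layer-ratio {n} F cx i = *-cancelˡ-≤ (suc i) (+-cancelʳ-≤ (i * f₀ * c₀) _ _ (begin
    suc i * (f₁ * c₀) + i * f₀ * c₀       ≡⟨ e₁ i f₀ f₁ c₀ ⟩
    (suc i * f₁ + i * f₀) * c₀            ≤⟨ *-monoˡ-≤ c₀ (local-LYM F cx i) ⟩
    n * f₀ * c₀                           ≡⟨ e₂ n f₀ c₀ ⟩
    f₀ * (n * c₀)                         ≡⟨ cong (f₀ *_) (C-absorb n i) ⟨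
    f₀ * (suc i * c₁ + i * c₀)            ≡⟨ e₃ i f₀ c₀ c₁ ⟩
    suc i * (f₀ * c₁) + i * f₀ * c₀       ∎))
    where
    open ≤-Reasoning
    f₀ f₁ c₀ c₁ : ℕ
    f₀ = layer F i
    f₁ = layer F (suc i)
    c₀ = n C i
    c₁ = n C suc i
    e₁ : ∀ i f₀ f₁ c₀ → suc i * (f₁ * c₀) + i * f₀ * c₀ ≡ (suc i * f₁ + i * f₀) * c₀
    e₁ = solve-∀
    e₂ : ∀ n f₀ c₀ → n * f₀ * c₀ ≡ f₀ * (n * c₀)
    e₂ = solve-∀
    e₃ : ∀ i f₀ c₀ c₁ → f₀ * (suc i * c₁ + i * c₀) ≡ suc i * (f₀ * c₁) + i * f₀ * c₀
    e₃ = solve-∀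

  -- A complex with a k-element member contains all subsets of it.
  containment : ∀ {n} (F : Family n) → IsComplex F → ∀ {k} → 1 ≤ layer F k → ∀ i → k C i ≤ layer F i
  containment {zero}  F cx {zero} h zero    = h
  containment {zero}  F cx {zero} h (suc i) = z≤n
  containment {suc n} F cx {k}    h i with 1 ≤? layer (deletion F) k
  ... | yes in-deletion = ≤-trans (containment (deletion F) (deletion-complex cx) in-deletion i) (layer-deletion-≤ F i)
  containment {suc n} F cx {zero}  h i | no not-in-deletion = contradiction h not-in-deletion
  containment {suc n} F cx {suc k} h i | no not-in-deletion = from-link i
    where
    in-link : 1 ≤ layer (link F) k
    in-link = subst (1 ≤_) (cong (_+ layer (link F) k) (n<1⇒n≡0 (≰⇒> not-in-deletion))) h
    below-in-deletion : ∀ i → k C i ≤ layer (deletion F) i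
    below-in-deletion = containment (deletion F) (deletion-complex cx) (≤-trans in-link (layer-mono (link⊆deletion cx) k))
    from-link : ∀ i → suc k C i ≤ layer F i
    from-link zero    = below-in-deletion zero
    from-link (suc i) = subst (_≤ layer F (suc i)) (trans (+-comm (k C suc i) (k C i)) (sym (C-pascal k i)))
      (+-mono-≤ (below-in-deletion (suc i)) (containment (link F) (link-complex cx) in-link i))

module Decomposition where
  open import Data.Nat.Base as ℕ using ()
  import Data.Nat.Properties as ℕₚ
  open import Data.Nat.Combinatorics using (_C_)
  open import Data.Product using (_×_; _,_)
  open import Data.Sum using (_⊎_; [_,_]′)
  open import Data.Rational.Base using (ℚ; 0ℚ; 1ℚ; _+_; _-_; -_; _*_; _≤_)
  open import Data.Rational.Properties
  open import Tactic.RingSolver using (solve-∀)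
  open Rationals
  open SummationByParts using (abel-≤)
  open Sums +-0-isCommutativeMonoid
  open Layers
  open Complexes using (layer-≤-C; layer-ratio)
  open PartialSums using (MeanDominates)

  module _ {ℓ a : ℕ} (F : Family (ℓ ℕ.+ a)) where
    private
      n : ℕ
      n = ℓ ℕ.+ a

    c : ℕ → ℚ
    c i = ℕtoℚ (n C i)

    density : ℕ → ℚ
    density i = layer F i ÷ (n C i)

    lower-part upper-part : ℚ
    lower-part = ∑ ℓ (λ i → (1ℚ - density i) * (c ℓ - c i))
    upper-part = ∑ (suc a) (λ j → density (ℓ ℕ.+ j) * (c (ℓ ℕ.+ j) - c ℓ))

    split-at-ℓ : ∀ h → ∑ (suc n) h ≡ ∑ ℓ h + ∑ (suc a) (λ j → h (ℓ ℕ.+ j))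
    split-at-ℓ h = trans (cong (λ m → ∑ m h) (sym (ℕₚ.+-suc ℓ a))) (∑-+ ℓ (suc a) h)

    binomSumBelow-∑ : ∀ k → ℕtoℚ (binomSumBelow n k) ≡ ∑ k c
    binomSumBelow-∑ zero    = refl
    binomSumBelow-∑ (suc k) = begin
      ℕtoℚ (binomSumBelow n k ℕ.+ n C k)   ≡⟨ ℕtoℚ-homo-+ (binomSumBelow n k) (n C k) ⟩
      ℕtoℚ (binomSumBelow n k) + c k       ≡⟨ cong (_+ c k) (binomSumBelow-∑ k) ⟩
      ∑ k c + c k                          ≡⟨ ∑-last k c ⟨
      ∑ (suc k) c                          ∎
      where open ≡-Reasoning

    card-density : ℕtoℚ (card F) ≡ ∑ (suc n) (λ i → density i * c i)
    card-density = trans (card-layers F)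
      (∑-cong (suc n) (λ i i≤n → sym (÷-inverse (layer F i) (Binomial.C-pos (ℕₚ.≤-pred i≤n)))))

    decomposition : ℕtoℚ (card F) ≡ (ℕtoℚ (binomSumBelow n ℓ) + (norm F - ℕtoℚ ℓ) * c ℓ) + (lower-part + upper-part)
    decomposition = begin
      ℕtoℚ (card F)
        ≡⟨ trans card-density (split-at-ℓ (λ i → density i * c i)) ⟩
      ∑ ℓ (λ i → density i * c i) + ∑ (suc a) (λ j → y j * c′ j)
        ≡⟨ cong₂ _+_ lower-sum upper-sum ⟩
      (((B + Pd * Cℓ) + ℕtoℚ ℓ * - Cℓ) + lower-part) + (Qd * Cℓ + upper-part)
        ≡⟨ collect B Pd Qd (ℕtoℚ ℓ) Cℓ lower-part upper-part ⟩
      (B + ((Pd + Qd) - ℕtoℚ ℓ) * Cℓ) + (lower-part + upper-part)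
        ≡⟨ cong (λ m → (B + (m - ℕtoℚ ℓ) * Cℓ) + (lower-part + upper-part)) norm-split ⟨
      (B + (norm F - ℕtoℚ ℓ) * Cℓ) + (lower-part + upper-part)
        ∎
      where
      open ≡-Reasoning
      lower-term : ∀ x c Cℓ → x * c ≡ ((c + x * Cℓ) + - Cℓ) + (1ℚ - x) * (Cℓ - c)
      lower-term = solve-∀ ℚ-ring
      upper-term : ∀ x c Cℓ → x * c ≡ x * Cℓ + x * (c - Cℓ)
      upper-term = solve-∀ ℚ-ring
      collect : ∀ B Pd Qd L Cℓ S₁ S₂ →
                (((B + Pd * Cℓ) + L * - Cℓ) + S₁) + (Qd * Cℓ + S₂) ≡ (B + ((Pd + Qd) - L) * Cℓ) + (S₁ + S₂)
      collect = solve-∀ ℚ-ring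
      y c′ : ℕ → ℚ
      y j = density (ℓ ℕ.+ j)
      c′ j = c (ℓ ℕ.+ j)
      B Cℓ Pd Qd : ℚ
      B = ℕtoℚ (binomSumBelow n ℓ)
      Cℓ = c ℓ
      Pd = ∑ ℓ density
      Qd = ∑ (suc a) y
      norm-split : norm F ≡ Pd + Qd
      norm-split = trans (norm-layers F) (split-at-ℓ density)
      lower-sum : ∑ ℓ (λ i → density i * c i) ≡ ((B + Pd * Cℓ) + ℕtoℚ ℓ * - Cℓ) + lower-part
      lower-sum = begin
        ∑ ℓ (λ i → density i * c i)
          ≡⟨ ∑-cong ℓ (λ i _ → lower-term (density i) (c i) Cℓ) ⟩
        ∑ ℓ (λ i → ((c i + density i * Cℓ) + - Cℓ) + (1ℚ - density i) * (Cℓ - c i))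
          ≡⟨ ∑-distrib ℓ (λ i → (c i + density i * Cℓ) + - Cℓ) (λ i → (1ℚ - density i) * (Cℓ - c i)) ⟩
        ∑ ℓ (λ i → (c i + density i * Cℓ) + - Cℓ) + lower-part
          ≡⟨ cong (_+ lower-part) (∑-distrib ℓ (λ i → c i + density i * Cℓ) (λ _ → - Cℓ)) ⟩
        (∑ ℓ (λ i → c i + density i * Cℓ) + ∑ ℓ (λ _ → - Cℓ)) + lower-part
          ≡⟨ cong₂ (λ p q → (p + q) + lower-part) (∑-distrib ℓ c (λ i → density i * Cℓ)) (∑-const ℓ (- Cℓ)) ⟩
        ((∑ ℓ c + ∑ ℓ (λ i → density i * Cℓ)) + ℕtoℚ ℓ * - Cℓ) + lower-part
          ≡⟨ cong₂ (λ p q → ((p + q) + ℕtoℚ ℓ * - Cℓ) + lower-part) (sym (binomSumBelow-∑ ℓ)) (sym (*-distribʳ-∑ Cℓ ℓ density)) ⟩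
        ((B + Pd * Cℓ) + ℕtoℚ ℓ * - Cℓ) + lower-part
          ∎
      upper-sum : ∑ (suc a) (λ j → y j * c′ j) ≡ Qd * Cℓ + upper-part
      upper-sum = begin
        ∑ (suc a) (λ j → y j * c′ j)
          ≡⟨ ∑-cong (suc a) (λ j _ → upper-term (y j) (c′ j) Cℓ) ⟩
        ∑ (suc a) (λ j → y j * Cℓ + y j * (c′ j - Cℓ))
          ≡⟨ ∑-distrib (suc a) (λ j → y j * Cℓ) (λ j → y j * (c′ j - Cℓ)) ⟩
        ∑ (suc a) (λ j → y j * Cℓ) + upper-part
          ≡⟨ cong (_+ upper-part) (*-distribʳ-∑ Cℓ (suc a) y) ⟨
        Qd * Cℓ + upper-part
          ∎

    density-≤-1 : ∀ i → i ℕ.≤ n → density i ≤ 1ℚ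
    density-≤-1 i i≤n = ÷-mono-≤ {layer F i} {n C i} {1} {1} (Binomial.C-pos i≤n) ℕₚ.≤-refl
      (ℕₚ.≤-trans (ℕₚ.≤-reflexive (ℕₚ.*-identityʳ (layer F i))) (ℕₚ.≤-trans (layer-≤-C F i) (ℕₚ.≤-reflexive (sym (ℕₚ.*-identityˡ (n C i))))))

    density-antitone : IsComplex F → ∀ i → suc i ℕ.≤ n → density (suc i) ≤ density i
    density-antitone cx i i<n = ÷-mono-≤ {layer F (suc i)} {n C suc i} {layer F i} {n C i} (Binomial.C-pos i<n) (Binomial.C-pos (ℕₚ.<⇒≤ i<n)) (layer-ratio F cx i)

    density-empty : ∀ {i} → layer F i ≡ 0 → density i ≡ 0ℚ
    density-empty {i} f≡0 = trans (cong (_÷ (n C i)) f≡0) (*-zeroˡ (inv (n C i)))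

    lower-part-nonNeg : 2 ℕ.* ℓ ℕ.≤ suc n → 0ℚ ≤ lower-part
    lower-part-nonNeg 2ℓ≤n+1 = ∑-nonNeg ℓ λ i i<ℓ →
      0≤* (p≤q⇒0≤q-p (density-≤-1 i (ℕₚ.≤-trans (ℕₚ.<⇒≤ i<ℓ) (ℕₚ.m≤m+n ℓ a))))
          (p≤q⇒0≤q-p (ℕtoℚ-mono-≤ (Binomial.C-mono-≤ (ℕₚ.<⇒≤ i<ℓ) 2ℓ≤n+1)))

    TailCondition : Set
    TailCondition = ∀ t → t ℕ.< a → MeanDominates n ℓ (suc t) ⊎ (layer F (ℓ ℕ.+ t) ≡ 0 × layer F (ℓ ℕ.+ suc t) ≡ 0)

    upper-part-nonNeg : IsComplex F → layer F n ≡ 0 → TailCondition → 0ℚ ≤ upper-part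
    upper-part-nonNeg cx top-empty tail = ≤-trans (≤-reflexive (sym top-vanishes)) (abel-≤ a y e step-nonNeg)
      where
      y e : ℕ → ℚ
      y j = density (ℓ ℕ.+ j)
      e j = c (ℓ ℕ.+ j) - c ℓ
      top-vanishes : y a * ∑ (suc a) e ≡ 0ℚ
      top-vanishes = trans (cong (_* ∑ (suc a) e) (density-empty top-empty)) (*-zeroˡ (∑ (suc a) e))
      partial-sum : ∀ t → ∑ t e ≡ ℕtoℚ (ℕ∑.∑ t (λ j → n C (ℓ ℕ.+ j))) - ℕtoℚ (t ℕ.* (n C ℓ))
      partial-sum t = begin
        ∑ t e                                                    ≡⟨ ∑-sub t (λ j → c (ℓ ℕ.+ j)) (λ _ → c ℓ) ⟩
        ∑ t (λ j → c (ℓ ℕ.+ j)) - ∑ t (λ _ → c ℓ)                  ≡⟨ cong₂ _-_ (sym (ℕtoℚ-∑ t (λ j → n C (ℓ ℕ.+ j)))) (trans (∑-const t (c ℓ)) (sym (ℕtoℚ-homo-* t (n C ℓ)))) ⟩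
        ℕtoℚ (ℕ∑.∑ t (λ j → n C (ℓ ℕ.+ j))) - ℕtoℚ (t ℕ.* (n C ℓ)) ∎
        where open ≡-Reasoning
      partial-sum-nonNeg : ∀ t → MeanDominates n ℓ t → 0ℚ ≤ ∑ t e
      partial-sum-nonNeg t mean-dominates = subst (0ℚ ≤_) (sym (partial-sum t))
        (p≤q⇒0≤q-p {ℕtoℚ (t ℕ.* (n C ℓ))} {ℕtoℚ (ℕ∑.∑ t (λ j → n C (ℓ ℕ.+ j)))}
          (ℕtoℚ-mono-≤ mean-dominates))
      density-drop : ∀ t → t ℕ.< a → 0ℚ ≤ y t - y (suc t)
      density-drop t t<a = p≤q⇒0≤q-p {y (suc t)} {y t} (subst (λ k → density k ≤ y t) (sym (ℕₚ.+-suc ℓ t))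
        (density-antitone cx (ℓ ℕ.+ t) (ℕₚ.≤-trans (ℕₚ.≤-reflexive (sym (ℕₚ.+-suc ℓ t))) (ℕₚ.+-monoʳ-≤ ℓ t<a))))
      step-nonNeg : ∀ t → t ℕ.< a → 0ℚ ≤ (y t - y (suc t)) * ∑ (suc t) e
      step-nonNeg t t<a = [ dominated , empty ]′ (tail t t<a)
        where
        dominated : MeanDominates n ℓ (suc t) → 0ℚ ≤ (y t - y (suc t)) * ∑ (suc t) e
        dominated mean-dominates = 0≤* {y t - y (suc t)} {∑ (suc t) e} (density-drop t t<a) (partial-sum-nonNeg (suc t) mean-dominates)
        empty : layer F (ℓ ℕ.+ t) ≡ 0 × layer F (ℓ ℕ.+ suc t) ≡ 0 → 0ℚ ≤ (y t - y (suc t)) * ∑ (suc t) e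
        empty (empty₀ , empty₁) = subst (λ d → 0ℚ ≤ d * ∑ (suc t) e) (sym no-drop) (≤-reflexive (sym (*-zeroˡ (∑ (suc t) e))))
          where
          no-drop : y t - y (suc t) ≡ 0ℚ
          no-drop = trans (cong₂ _-_ (density-empty empty₀) (density-empty empty₁)) (+-inverseʳ 0ℚ)

    complex-Ineq : IsComplex F → 2 ℕ.* ℓ ℕ.≤ suc n → layer F n ≡ 0 → TailCondition → Ineq n ℓ F
    complex-Ineq cx 2ℓ≤n+1 top-empty tail = subst (ℕtoℚ (binomSumBelow n ℓ) + (norm F - ℕtoℚ ℓ) * c ℓ ≤_) (sym decomposition)
      (p≤p+q (+-mono-≤ (lower-part-nonNeg 2ℓ≤n+1) (upper-part-nonNeg cx top-empty tail)))
      where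
      p≤p+q : ∀ {p q} → 0ℚ ≤ q → p ≤ p + q
      p≤p+q {p} {q} 0≤q = subst (_≤ p + q) (+-identityʳ p) (+-monoʳ-≤ p 0≤q)

module TopLayers where
  open import Data.Nat.Base as ℕ using (_∸_)
  import Data.Nat.Properties as ℕₚ
  open import Data.Nat.Combinatorics using (_C_)
  open import Data.Integer.Base using (+_)
  open import Data.Rational.Base using (1ℚ; _/_; _*_; _≤_; _<_)
  open import Data.Rational.Properties
  open import Relation.Nullary using (¬_; contradiction)
  open Rationals
  open Sums +-0-isCommutativeMonoid
  open Layers
  open Complexes using (containment)
  open Binomial using (C-pos; C-suc)

  <⇒≱ : ∀ {p q} → p < q → ¬ (q ≤ p)
  <⇒≱ p<q q≤p = <-irrefl refl (<-≤-trans p<q q≤p)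

  norm-≥-sub-row : ∀ {n} (F : Family n) → IsComplex F → ∀ {k} → 1 ℕ.≤ layer F k →
                   ∑ (suc n) (λ i → (k C i) ÷ (n C i)) ≤ norm F
  norm-≥-sub-row {n} F cx {k} in-layer = subst (∑ (suc n) (λ i → (k C i) ÷ (n C i)) ≤_) (sym (norm-layers F))
    (∑-mono-≤ (suc n) λ i i≤n → ÷-mono-≤ {k C i} {n C i} {layer F i} {n C i} (C-pos (ℕₚ.≤-pred i≤n)) (C-pos (ℕₚ.≤-pred i≤n))
                                  (ℕₚ.*-monoˡ-≤ (n C i) (containment F cx in-layer i)))

  top-layer-empty : ∀ {n} (F : Family n) → IsComplex F → norm F < ℕtoℚ (suc n) → layer F n ≡ 0
  top-layer-empty {n} F cx norm<n+1 with layer F n in eq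
  ... | zero  = refl
  ... | suc _ = contradiction (begin
    ℕtoℚ (suc n)                        ≡⟨ trans (∑-const (suc n) 1ℚ) (*-identityʳ _) ⟨
    ∑ (suc n) (λ _ → 1ℚ)                ≡⟨ ∑-cong (suc n) (λ i i≤n → ÷-self (C-pos (ℕₚ.≤-pred i≤n))) ⟨
    ∑ (suc n) (λ i → (n C i) ÷ (n C i))   ≤⟨ norm-≥-sub-row F cx (ℕₚ.≤-trans (ℕ.s≤s ℕ.z≤n) (ℕₚ.≤-reflexive (sym eq))) ⟩
    norm F                              ∎) (<⇒≱ norm<n+1)
    where open ≤-Reasoning

  C-pred : ∀ m {i} → i ℕ.≤ suc m → (suc m ∸ i) ℕ.* (suc m C i) ≡ suc m ℕ.* (m C i)
  C-pred m {i} i≤n = ℕₚ.+-cancelˡ-≡ (i ℕ.* (suc m C i)) _ _ (begin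
    i ℕ.* (suc m C i) ℕ.+ (suc m ∸ i) ℕ.* (suc m C i) ≡⟨ ℕₚ.*-distribʳ-+ (suc m C i) i (suc m ∸ i) ⟨
    (i ℕ.+ (suc m ∸ i)) ℕ.* (suc m C i)               ≡⟨ cong (ℕ._* (suc m C i)) (ℕₚ.m+[n∸m]≡n i≤n) ⟩
    suc m ℕ.* (suc m C i)                              ≡⟨ C-suc m i ⟨
    i ℕ.* (suc m C i) ℕ.+ suc m ℕ.* (m C i)           ∎)
    where open ≡-Reasoning

  -- Containing an (n-1)-set forces ‖F‖ ≥ ∑ (n-i)/n = (n+1)/2.
  second-layer-empty : ∀ {n} (F : Family n) → IsComplex F → norm F < + suc n / 2 → ∀ {m} → n ≡ suc m → layer F m ≡ 0
  second-layer-empty F cx norm<half {m} refl with layer F m in eq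
  ... | zero  = refl
  ... | suc _ = contradiction (begin
    + suc n / 2                                   ≡⟨ /≡÷ (suc n) 1 ⟩
    suc n ÷ 2                                     ≤⟨ ÷-mono-≤ {suc n} {2} {S} {n} (ℕ.s≤s ℕ.z≤n) (ℕ.s≤s ℕ.z≤n)
                                                        (ℕₚ.≤-reflexive (trans (ℕₚ.*-comm (suc n) n) (sym (NatSums.gauss n)))) ⟩
    S ÷ n                                         ≡⟨ cong (_* inv n) (ℕtoℚ-∑ (suc n) (n ∸_)) ⟩
    ∑ (suc n) (λ i → ℕtoℚ (n ∸ i)) * inv n        ≡⟨ *-distribʳ-∑ (inv n) (suc n) (λ i → ℕtoℚ (n ∸ i)) ⟩
    ∑ (suc n) (λ i → (n ∸ i) ÷ n)                 ≤⟨ ∑-mono-≤ (suc n) (λ i i≤n → ÷-mono-≤ {n ∸ i} {n} {m C i} {n C i}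
                                                        (ℕ.s≤s ℕ.z≤n) (C-pos (ℕₚ.≤-pred i≤n))
                                                        (ℕₚ.≤-reflexive (trans (C-pred m (ℕₚ.≤-pred i≤n)) (ℕₚ.*-comm n (m C i))))) ⟩
    ∑ (suc n) (λ i → (m C i) ÷ (n C i))           ≤⟨ norm-≥-sub-row F cx {m} (ℕₚ.≤-trans (ℕ.s≤s ℕ.z≤n) (ℕₚ.≤-reflexive (sym eq))) ⟩
    norm F                                        ∎) (<⇒≱ norm<half)
    where
    open ≤-Reasoning
    n S : ℕ
    n = suc m
    S = ℕ∑.∑ (suc n) (n ∸_)

module PerfectPairs where
  open import Data.Nat.Base using (_+_; _*_; _≤_; _<_)
  open import Data.Nat.Properties
  open import Data.Integer.Base using (+_)
  import Data.Rational.Base as ℚ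
  import Data.Rational.Properties as ℚₚ
  open import Data.Product using (_×_; _,_)
  open import Data.Sum using (inj₁; inj₂)
  open import Relation.Nullary using (¬_; yes; no)
  open Rationals using (÷-mono-≤; /≡÷)
  open Layers using (layer)
  open PartialSums using (MeanDominates; meanDominates-≤; Exceptional; meanDominates-quasi; meanDominates-perfect)
  open Decomposition using (TailCondition; complex-Ineq)
  open TopLayers using (top-layer-empty; second-layer-empty)

  2ℓ≤a⇒2ℓ≤n+1 : ∀ {ℓ a} → 2 * ℓ ≤ a → 2 * ℓ ≤ suc (ℓ + a)
  2ℓ≤a⇒2ℓ≤n+1 {ℓ} {a} 2ℓ≤a = ≤-trans 2ℓ≤a (≤-trans (m≤n+m a ℓ) (n≤1+n (ℓ + a)))

  perfect : ∀ ℓ a → 2 * ℓ ≤ a → MeanDominates (ℓ + a) ℓ a → Perfect (ℓ + a) ℓ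
  perfect ℓ a 2ℓ≤a mean-dominates F cx norm<n+1 = complex-Ineq {ℓ} {a} F cx 2ℓ≤n+1 (top-layer-empty F cx norm<n+1)
    λ t t<a → inj₁ (meanDominates-≤ (ℓ + a) ℓ 2ℓ≤n+1 mean-dominates t<a)
    where
    2ℓ≤n+1 : 2 * ℓ ≤ suc (ℓ + a)
    2ℓ≤n+1 = 2ℓ≤a⇒2ℓ≤n+1 2ℓ≤a

  quasiPerfect : ∀ ℓ b → 2 * ℓ ≤ suc b → MeanDominates (ℓ + suc b) ℓ b → QuasiPerfect (ℓ + suc b) ℓ
  quasiPerfect ℓ b 2ℓ≤a mean-dominates F cx norm<half = complex-Ineq {ℓ} {suc b} F cx 2ℓ≤n+1 top-empty tail
    where
    n = ℓ + suc b
    2ℓ≤n+1 : 2 * ℓ ≤ suc n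
    2ℓ≤n+1 = 2ℓ≤a⇒2ℓ≤n+1 2ℓ≤a
    half≤whole : + suc n ℚ./ 2 ℚ.≤ ℕtoℚ (suc n)
    half≤whole = ℚₚ.≤-trans (ℚₚ.≤-reflexive (/≡÷ (suc n) 1))
      (ℚₚ.≤-trans (÷-mono-≤ {suc n} {2} {suc n} {1} (s≤s z≤n) ≤-refl (*-monoʳ-≤ (suc n) (s≤s z≤n))) (ℚₚ.≤-reflexive (ℚₚ.*-identityʳ _)))
    top-empty : layer F n ≡ 0
    top-empty = top-layer-empty F cx (ℚₚ.<-≤-trans norm<half half≤whole)
    tail : TailCondition {ℓ} {suc b} F
    tail t t<a with suc t ≤? b
    ... | yes t<b = inj₁ (meanDominates-≤ n ℓ 2ℓ≤n+1 mean-dominates t<b)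
    ... | no  t≮b rewrite ≤-antisym (≤-pred t<a) (≤-pred (≰⇒> t≮b)) =
      inj₂ (second-layer-empty F cx norm<half (+-suc ℓ b) , top-empty)

  perfect-and-quasiPerfect : ∀ ℓ a → 0 < a → 2 * ℓ ≤ a →
                             QuasiPerfect (ℓ + a) ℓ × (¬ Exceptional (ℓ + a) ℓ → Perfect (ℓ + a) ℓ)
  perfect-and-quasiPerfect ℓ (suc b) _ 2ℓ≤a =
    quasiPerfect ℓ b 2ℓ≤a (meanDominates-quasi ℓ b 2ℓ≤a) ,
    λ unexceptional → perfect ℓ (suc b) 2ℓ≤a (meanDominates-perfect ℓ (suc b) 2ℓ≤a unexceptional)

open import Data.Nat using (ℕ; _<_; _≤_; _*_; _∸_)
open import Data.Nat.Properties using (<⇒≤; ≤-trans; ≤-reflexive; +-comm; m<n⇒0<n∸m; m+[n∸m]≡n; m+n≤o⇒m≤o∸n)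
open import Data.Product using (_×_)
open import Relation.Nullary using (¬_)
open import Relation.Binary.PropositionalEquality using (_≡_)
open PerfectPairs using (perfect-and-quasiPerfect)

proposition4p2 : (n ℓ : ℕ) → ℓ < n → 3 * ℓ ≤ n →
    QuasiPerfect n ℓ × (¬ (n ≡ 3 * ℓ × 2 ≤ ℓ × ℓ ≤ 5) → Perfect n ℓ)
proposition4p2 n ℓ ℓ<n 3ℓ≤n =
  subst (λ m → QuasiPerfect m ℓ × (¬ (m ≡ 3 * ℓ × 2 ≤ ℓ × ℓ ≤ 5) → Perfect m ℓ)) (m+[n∸m]≡n (<⇒≤ ℓ<n))
    (perfect-and-quasiPerfect ℓ (n ∸ ℓ) (m<n⇒0<n∸m ℓ<n) 2ℓ≤n-ℓ)
  where
  2ℓ≤n-ℓ : 2 * ℓ ≤ n ∸ ℓ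
  2ℓ≤n-ℓ = m+n≤o⇒m≤o∸n (2 * ℓ) (≤-trans (≤-reflexive (+-comm (2 * ℓ) ℓ)) 3ℓ≤n)
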